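{- Let $\mu\ge1$ and $m\ge1$ be integers. Define power series (functions of $t$ near $0$) recursively by $F_1(t)=-\log E_m(-t)$ and $F_{j+1}(t)=\int_0^t\frac{E_{m-1}(-s)}{1-E_m(-s)}F_j(s)\,ds$ for $j\ge1$, and similarly $G_1(t)=-\log\bigl(1+e^{ -t}-E_{m-1}(-t)\bigr)$ and $G_{j+1}(t)=\int_0^t\frac{e^{ -s}-E_{m-2}(-s)}{E_{m-1}(-s)-e^{ -s}}G_j(s)\,ds$ for $j\ge1$. Then $$\frac{F_\mu(t)}{1-E_m(-t)}=\sum_{n=0}^\infty B_{n,\le m}^{(\mu)}\frac{t^n}{n!}\qquad\text{and}\qquad \frac{G_\mu(t)}{E_{m-1}(-t)-e^{ -t}}=\sum_{n=0}^\infty B_{n,\ge m}^{(\mu)}\frac{t^n}{n!}.$$ (Equivalently, the left-hand sides are the $(\mu-1)$-fold iterated integrals $\frac{1}{1-E_m(-t)}\int_0^t\frac{E_{m-1}(-t)}{1-E_m(-t)}\int_0^t\cdots\frac{E_{m-1}(-t)}{1-E_m(-t)}\bigl(-\log E_m(-t)\bigr)\,dt\cdots dt$ and the analogous expression for the associated case.)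
   Context: $E_m(t)=\sum_{k=0}^m \frac{t^k}{k!}$ for $m\ge0$, and by convention $E_{ -1}(t)=0$. For integers $n,k\ge0$, $m\ge1$, $\left\{ {n \atop k} \right\}_{\le m}$ (resp. $\left\{ {n \atop k} \right\}_{\ge m}$) is the number of partitions of an $n$-element set into $k$ nonempty blocks each of size at most $m$ (resp. at least $m$), with the value $1$ for $n=k=0$. The restricted and associated poly-Bernoulli numbers are $$B_{n,\le m}^{(\mu)}=\sum_{k=0}^n(-1)^{n-k}\frac{k!}{(k+1)^\mu}\left\{ {n \atop k} \right\}_{\le m},\qquad B_{n,\ge m}^{(\mu)}=\sum_{k=0}^n(-1)^{n-k}\frac{k!}{(k+1)^\mu}\left\{ {n \atop k} \right\}_{\ge m}\qquad(n\ge0).$$ -}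

module Defs where

open import Data.Nat as ℕ using (ℕ; zero; suc; _!; _≤ᵇ_; _≡ᵇ_)
import Data.Nat.Properties as ℕP
open import Data.Integer as ℤ using (ℤ; +_)
open import Data.Rational as ℚ using (ℚ; 0ℚ; 1ℚ; _+_; _*_; -_; _-_; _/_; 1/_)
open import Data.Rational.Properties using (_≟_)
open import Data.Bool using (Bool; true; false; _∧_; if_then_else_)
open import Data.List as L using (List; []; _∷_; length; filter; upTo; concatMap; map)
open import Data.List.Relation.Unary.All using (All)
open import Relation.Nullary using (yes; no)
open import Relation.Binary.PropositionalEquality using (_≡_)

sumBelow : ℕ → (ℕ → ℚ) → ℚ
sumBelow zero    f = 0ℚ
sumBelow (suc n) f = sumBelow n f + f n

sumTo : ℕ → (ℕ → ℚ) → ℚ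
sumTo n f = sumBelow (suc n) f

sign : ℕ → ℚ
sign zero    = 1ℚ
sign (suc n) = - sign n

invFact : ℕ → ℚ
invFact n = (+ 1 / (n !)) {{ℕP._!≢0 n}}

-- 1/c if c ≠ 0, and 0 otherwise (only used for c ≠ 0)
recip : ℚ → ℚ
recip c with c ≟ 0ℚ
... | yes _  = 0ℚ
... | no c≢0 = (1/ c) {{ℚ.≢-nonZero c≢0}}

-- Formal power series over ℚ:  A = Σ_n A n · t^n

FPS : Set
FPS = ℕ → ℚ

zeroS : FPS
zeroS _ = 0ℚ

oneS : FPS
oneS zero    = 1ℚ
oneS (suc _) = 0ℚ

_+S_ : FPS → FPS → FPS
(A +S B) n = A n + B n

negS : FPS → FPS
negS A n = - A n

_-S_ : FPS → FPS → FPS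
A -S B = A +S negS B

scaleS : ℚ → FPS → FPS
scaleS c A n = c * A n

_*S_ : FPS → FPS → FPS
(A *S B) n = sumTo n (λ i → A i * B (n ℕ.∸ i))

powS : FPS → ℕ → FPS
powS A zero    = oneS
powS A (suc k) = A *S powS A k

-- multiplicative inverse of a series with nonzero constant term c:
--   1/A = c⁻¹ Σ_k (1 - c⁻¹A)^k   (a finite sum in each coefficient)
invS : FPS → FPS
invS A n = recip (A 0) * sumTo n (λ k → powS (oneS -S scaleS (recip (A 0)) A) k n)

-- formal logarithm of a series with constant term 1:
--   log A = Σ_{k≥1} (-1)^{k+1} (A - 1)^k / k
logS : FPS → FPS
logS A n = sumBelow n (λ k → sign k * ((+ 1 / suc k) * powS (A -S oneS) (suc k) n))

intS : FPS → FPS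
intS A zero    = 0ℚ
intS A (suc n) = (+ 1 / suc n) * A n

-- A / t^v  (drops the first v coefficients; exact when A is divisible by t^v)
shiftS : ℕ → FPS → FPS
shiftS v A n = A (v ℕ.+ n)

-- Quotient A / B of formal series where B has order exactly v
-- (coefficient of t^v nonzero, lower ones zero) and A is divisible by t^v:
--   A / B = (A / t^v) · (B / t^v)⁻¹
divS : ℕ → FPS → FPS → FPS
divS v A B = shiftS v A *S invS (shiftS v B)

expNeg : FPS
expNeg n = sign n * invFact n

-- Etr k = E_{k-1}(-t) = Σ_{i=0}^{k-1} (-t)^i / i!   (so Etr 0 = E_{-1}(-t) = 0)
Etr : ℕ → FPS
Etr k n = if suc n ≤ᵇ k then sign n * invFact n else 0ℚ

-- The series F_j and G_j (index j ≥ 1; index 0 is an unused dummy)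

Fser : (m : ℕ) → ℕ → FPS
Fser m zero                = zeroS
Fser m (suc zero)          = negS (logS (Etr (suc m)))
Fser m (suc (suc j))       =
  intS (divS 1 (Etr m *S Fser m (suc j)) (oneS -S Etr (suc m)))

-- G_1 = -log(1 + e^{-t} - E_{m-1}(-t)),
-- G_{j+1} = ∫_0^t (e^{-s} - E_{m-2}(-s)) G_j(s) / (E_{m-1}(-s) - e^{-s}) ds
-- (for m ≥ 1: E_{m-1} = Etr m, E_{m-2} = Etr (m - 1);
--  the denominator has order exactly m)
Gser : (m : ℕ) → ℕ → FPS
Gser m zero          = zeroS
Gser m (suc zero)    = negS (logS ((oneS +S expNeg) -S Etr m))
Gser m (suc (suc j)) =
  intS (divS m ((expNeg -S Etr (m ℕ.∸ 1)) *S Gser m (suc j)) (Etr m -S expNeg))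

-- Set partitions of {0,…,n-1}, encoded canonically as restricted growth
-- words: w i is the index of the block of i, blocks numbered in order
-- of their least element.

words : ℕ → ℕ → List (List ℕ)
words zero    k = [] ∷ []
words (suc n) k = concatMap (λ w → map (λ x → x ∷ w) (upTo k)) (words n k)

-- restricted-growth check: c = number of blocks opened so far; the
-- word must be restricted growth and open exactly k blocks in total
isRGS : ℕ → List ℕ → ℕ → Bool
isRGS c []       k = c ≡ᵇ k
isRGS c (x ∷ xs) k = (x ≤ᵇ c) ∧ isRGS (if x ≡ᵇ c then suc c else c) xs k

blockSize : ℕ → List ℕ → ℕ
blockSize j []       = zero
blockSize j (x ∷ xs) = if x ≡ᵇ j then suc (blockSize j xs) else blockSize j xs

allBlocks : (ℕ → Bool) → ℕ → List ℕ → Bool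
allBlocks p zero    w = true
allBlocks p (suc k) w = p (blockSize k w) ∧ allBlocks p k w

countIf : {A : Set} → (A → Bool) → List A → ℕ
countIf f []       = zero
countIf f (x ∷ xs) = if f x then suc (countIf f xs) else countIf f xs

-- number of partitions of an n-set into k nonempty blocks, each block
-- size satisfying p  (equals 1 for n = k = 0)
stirlingWith : (ℕ → Bool) → ℕ → ℕ → ℕ
stirlingWith p n k = countIf (λ w → isRGS 0 w k ∧ allBlocks p k w) (words n k)

stirlingLe : ℕ → ℕ → ℕ → ℕ
stirlingLe m = stirlingWith (λ s → s ≤ᵇ m)

stirlingGe : ℕ → ℕ → ℕ → ℕ
stirlingGe m = stirlingWith (λ s → m ≤ᵇ s)

polyBernoulliWith : (ℕ → ℕ → ℕ) → ℕ → ℕ → ℚ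
polyBernoulliWith S μ n =
  sumTo n (λ k → sign (n ℕ.∸ k)
                 * ((+ (k !) / (suc k ℕ.^ μ)) {{ℕP.m^n≢0 (suc k) μ}}
                 * (+ S n k / 1)))

BLe : (μ m n : ℕ) → ℚ
BLe μ m n = polyBernoulliWith (stirlingLe m) μ n

BGe : (μ m n : ℕ) → ℚ
BGe μ m n = polyBernoulliWith (stirlingGe m) μ n

{-# OPTIONS --safe #-}
-- Both left-hand sides have the form  H μ / u  with  H 1 = −log(1 − u)  and
-- H (j+1) = ∫ u′ H j / u,  where  u = 1 − E_m(−t)  resp.  u = E_{m−1}(−t) − e^{−t}.
-- Induction on μ gives  H μ = Σ_{k≥0} u^{k+1}/(k+1)^μ:  the base case is the
-- logarithm series, and the step holds because the derivative of the right-hand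
-- side for μ+1 is u′ Σ_k u^k/(k+1)^μ.  So the quotient is Σ_k u^k/(k+1)^μ.
-- In both cases u(t) = −T(−t), where T is the exponential generating function of a
-- single admissible block, and n! [t^n] T^k / k! counts partitions of an n-set into
-- k admissible blocks; the substitution t ↦ −t produces the sign (−1)^{n−k}.
-- For partitions encoded as restricted growth words this count is proved for
-- partially built words, where removing the first letter corresponds to
-- differentiating the generating function.
module Submission where

open import Defs
open import Algebra.Bundles using (CommutativeMonoid)
open import Data.Bool using (Bool; true; false; _∧_; if_then_else_)
open import Data.Bool.Properties using (T-≡; if-cong)
open import Data.Empty using (⊥-elim)
open import Data.Integer as ℤ using (+_)
import Data.Integer.Properties as ℤP
open import Data.List using (List; []; _∷_; _++_; map; applyUpTo; upTo; concatMap)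
open import Data.Nat as ℕ using (ℕ; zero; suc; _!; _∸_; _^_; _≤ᵇ_; _≡ᵇ_; _≤_; _<_; z≤n; s≤s)
import Data.Nat.Properties as ℕP
open import Data.Product using (_×_; _,_)
open import Data.Rational as ℚ using (ℚ; 0ℚ; 1ℚ; _+_; _*_; -_; _/_)
import Data.Rational.Properties as ℚP
import Data.Rational.Unnormalised as ℚᵘ
import Data.Rational.Unnormalised.Properties as ℚᵘP
open import Data.Rational.Solver using (module +-*-Solver)
open import Data.Sum using (inj₁; inj₂)
open import Function.Bundles using (Equivalence)
open import Relation.Binary.Bundles using (Setoid)
import Relation.Binary.Reasoning.Setoid as SetoidReasoning
open import Relation.Binary.PropositionalEquality
open import Relation.Nullary using (yes; no)

open +-*-Solver using (solve; _:+_; _:*_; :-_; _:=_; con)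
open import Algebra.Properties.CommutativeSemigroup
  (CommutativeMonoid.commutativeSemigroup ℚP.*-1-commutativeMonoid)
  using () renaming (x∙yz≈y∙xz to x*yz≡y*xz)
open import Algebra.Properties.CommutativeSemigroup
  (CommutativeMonoid.commutativeSemigroup ℚP.+-0-commutativeMonoid)
  using () renaming (interchange to +-interchange)

fromℕ : ℕ → ℚ
fromℕ n = + n / 1

/-cross : ∀ a b d e .{{_ : ℕ.NonZero d}} .{{_ : ℕ.NonZero e}} →
          a ℕ.* e ≡ b ℕ.* d → + a / d ≡ + b / e
/-cross a b (suc d) (suc e) eq = ℚP.fromℚᵘ-cong {ℚᵘ.mkℚᵘ (+ a) d} {ℚᵘ.mkℚᵘ (+ b) e}
  (ℚᵘ.*≡* (trans (sym (ℤP.pos-* a (suc e))) (trans (cong +_ eq) (ℤP.pos-* b (suc d)))))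
/-cross a b zero    e       eq = ⊥-elim (ℕ.≢-nonZero⁻¹ zero refl)
/-cross a b (suc d) zero    eq = ⊥-elim (ℕ.≢-nonZero⁻¹ zero refl)

/-*-/ : ∀ a b d e .{{_ : ℕ.NonZero d}} .{{_ : ℕ.NonZero e}} →
        (+ a / d) * (+ b / e) ≡ (+ (a ℕ.* b) / (d ℕ.* e)) {{ℕP.m*n≢0 d e}}
/-*-/ a b (suc d) (suc e) = begin
  p * q                                           ≡⟨ sym (ℚP.fromℚᵘ-toℚᵘ (p * q)) ⟩
  ℚ.fromℚᵘ (ℚ.toℚᵘ (p * q))                       ≡⟨ ℚP.fromℚᵘ-cong (ℚᵘP.≃-trans (ℚP.toℚᵘ-homo-* p q)
                                                       (ℚᵘP.*-cong (ℚP.toℚᵘ-fromℚᵘ (ℚᵘ.mkℚᵘ (+ a) d))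
                                                                   (ℚP.toℚᵘ-fromℚᵘ (ℚᵘ.mkℚᵘ (+ b) e)))) ⟩
  ℚ.fromℚᵘ (ℚᵘ.mkℚᵘ (+ a) d ℚᵘ.* ℚᵘ.mkℚᵘ (+ b) e) ≡⟨ ℚP./-cong (sym (ℤP.pos-* a b)) refl ⟩
  + (a ℕ.* b) / (suc d ℕ.* suc e)                 ∎
  where
  open ≡-Reasoning
  p = + a / suc d
  q = + b / suc e
/-*-/ a b zero    e    = ⊥-elim (ℕ.≢-nonZero⁻¹ zero refl)
/-*-/ a b (suc d) zero = ⊥-elim (ℕ.≢-nonZero⁻¹ zero refl)

fromℕ-+ : ∀ a b → fromℕ (a ℕ.+ b) ≡ fromℕ a + fromℕ b
fromℕ-+ a b = sym (begin
  fromℕ a + fromℕ b                                ≡⟨ sym (ℚP.fromℚᵘ-toℚᵘ (fromℕ a + fromℕ b)) ⟩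
  ℚ.fromℚᵘ (ℚ.toℚᵘ (fromℕ a + fromℕ b))            ≡⟨ ℚP.fromℚᵘ-cong (ℚᵘP.≃-trans (ℚP.toℚᵘ-homo-+ (fromℕ a) (fromℕ b))
                                                       (ℚᵘP.+-cong (ℚP.toℚᵘ-fromℚᵘ (ℚᵘ.mkℚᵘ (+ a) 0))
                                                                   (ℚP.toℚᵘ-fromℚᵘ (ℚᵘ.mkℚᵘ (+ b) 0)))) ⟩
  ℚ.fromℚᵘ (ℚᵘ.mkℚᵘ (+ a) 0 ℚᵘ.+ ℚᵘ.mkℚᵘ (+ b) 0)  ≡⟨ ℚP./-cong numerator refl ⟩
  fromℕ (a ℕ.+ b)                                  ∎)
  where
  open ≡-Reasoning
  numerator : + a ℤ.* + 1 ℤ.+ + b ℤ.* + 1 ≡ + (a ℕ.+ b)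
  numerator = trans (cong₂ ℤ._+_ (ℤP.*-identityʳ (+ a)) (ℤP.*-identityʳ (+ b))) (sym (ℤP.pos-+ a b))

fromℕ-* : ∀ a b → fromℕ (a ℕ.* b) ≡ fromℕ a * fromℕ b
fromℕ-* a b = sym (/-*-/ a b 1 1)

/≡fromℕ*1/ : ∀ a d .{{_ : ℕ.NonZero d}} → + a / d ≡ fromℕ a * (+ 1 / d)
/≡fromℕ*1/ a d = sym (trans (/-*-/ a 1 1 d) (/-cross (a ℕ.* 1) a (1 ℕ.* d) d {{ℕP.m*n≢0 1 d}}
  (cong₂ ℕ._*_ (ℕP.*-identityʳ a) (sym (ℕP.*-identityˡ d)))))

1/n*n≡1 : ∀ d .{{_ : ℕ.NonZero d}} → (+ 1 / d) * fromℕ d ≡ 1ℚ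
1/n*n≡1 d = trans (/-*-/ 1 d d 1) (/-cross (1 ℕ.* d) 1 (d ℕ.* 1) 1 {{ℕP.m*n≢0 d 1}}
  (trans (ℕP.*-identityʳ (1 ℕ.* d)) (cong (1 ℕ.*_) (sym (ℕP.*-identityʳ d)))))

invFact-suc*suc : ∀ n → invFact (suc n) * fromℕ (suc n) ≡ invFact n
invFact-suc*suc n = begin
  invFact (suc n) * fromℕ (suc n)                  ≡⟨ cong (_* fromℕ (suc n)) (sym (/-*-/ 1 1 (suc n) (n !) {{_}} {{ℕP._!≢0 n}})) ⟩
  ((+ 1 / suc n) * invFact n) * fromℕ (suc n)      ≡⟨ solve 3 (λ a b c → (a :* b) :* c := (a :* c) :* b) refl
                                                        (+ 1 / suc n) (invFact n) (fromℕ (suc n)) ⟩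
  ((+ 1 / suc n) * fromℕ (suc n)) * invFact n      ≡⟨ cong (_* invFact n) (1/n*n≡1 (suc n)) ⟩
  1ℚ * invFact n                                   ≡⟨ ℚP.*-identityˡ _ ⟩
  invFact n                                        ∎
  where open ≡-Reasoning

invFact*!≡1 : ∀ n → invFact n * fromℕ (n !) ≡ 1ℚ
invFact*!≡1 n = 1/n*n≡1 (n !) {{ℕP._!≢0 n}}

sign*sign≡1 : ∀ n → sign n * sign n ≡ 1ℚ
sign*sign≡1 zero    = refl
sign*sign≡1 (suc n) = trans (solve 1 (λ a → (:- a) :* (:- a) := a :* a) refl (sign n)) (sign*sign≡1 n)

sign-+ : ∀ a b → sign (a ℕ.+ b) ≡ sign a * sign b
sign-+ zero    b = sym (ℚP.*-identityˡ _)
sign-+ (suc a) b = trans (cong -_ (sign-+ a b)) (ℚP.neg-distribˡ-* (sign a) (sign b))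

sign-∸ : ∀ n k → k ≤ n → sign (n ∸ k) ≡ sign n * sign k
sign-∸ n k k≤n = begin
  sign (n ∸ k)                      ≡⟨ sym (trans (cong (sign (n ∸ k) *_) (sign*sign≡1 k)) (ℚP.*-identityʳ _)) ⟩
  sign (n ∸ k) * (sign k * sign k)  ≡⟨ sym (ℚP.*-assoc (sign (n ∸ k)) (sign k) (sign k)) ⟩
  (sign (n ∸ k) * sign k) * sign k  ≡⟨ cong (_* sign k) (sym (sign-+ (n ∸ k) k)) ⟩
  sign (n ∸ k ℕ.+ k) * sign k       ≡⟨ cong (λ z → sign z * sign k) (ℕP.m∸n+n≡m k≤n) ⟩
  sign n * sign k                   ∎
  where open ≡-Reasoning

sign*invFact≢0 : ∀ n → sign n * invFact n ≢ 0ℚ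
sign*invFact≢0 n eq = 1≢0 (begin
  1ℚ                                               ≡⟨ sym (trans (cong₂ _*_ (sign*sign≡1 n) (invFact*!≡1 n)) (ℚP.*-identityˡ 1ℚ)) ⟩
  (sign n * sign n) * (invFact n * fromℕ (n !))    ≡⟨ solve 3 (λ s f N → (s :* s) :* (f :* N) := (s :* f) :* (s :* N)) refl
                                                        (sign n) (invFact n) (fromℕ (n !)) ⟩
  (sign n * invFact n) * (sign n * fromℕ (n !))    ≡⟨ cong (_* (sign n * fromℕ (n !))) eq ⟩
  0ℚ * (sign n * fromℕ (n !))                      ≡⟨ ℚP.*-zeroˡ (sign n * fromℕ (n !)) ⟩
  0ℚ                                               ∎)
  where
  open ≡-Reasoning
  1≢0 : 1ℚ ≢ 0ℚ
  1≢0 ()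

Σ-cong : ∀ n {f g : ℕ → ℚ} → (∀ i → i < n → f i ≡ g i) → sumBelow n f ≡ sumBelow n g
Σ-cong zero    h = refl
Σ-cong (suc n) h = cong₂ _+_ (Σ-cong n (λ i i<n → h i (ℕP.m<n⇒m<1+n i<n))) (h n ℕP.≤-refl)

Σ-cong′ : ∀ n {f g : ℕ → ℚ} → (∀ i → f i ≡ g i) → sumBelow n f ≡ sumBelow n g
Σ-cong′ n h = Σ-cong n (λ i _ → h i)

Σ-0 : ∀ n {f : ℕ → ℚ} → (∀ i → i < n → f i ≡ 0ℚ) → sumBelow n f ≡ 0ℚ
Σ-0 zero    h = refl
Σ-0 (suc n) h = cong₂ _+_ (Σ-0 n (λ i i<n → h i (ℕP.m<n⇒m<1+n i<n))) (h n ℕP.≤-refl)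

Σ-+ : ∀ n (f g : ℕ → ℚ) → sumBelow n (λ i → f i + g i) ≡ sumBelow n f + sumBelow n g
Σ-+ zero    f g = refl
Σ-+ (suc n) f g = trans (cong (_+ (f n + g n)) (Σ-+ n f g)) (+-interchange (sumBelow n f) (sumBelow n g) (f n) (g n))

Σ-*ˡ : ∀ n c (f : ℕ → ℚ) → c * sumBelow n f ≡ sumBelow n (λ i → c * f i)
Σ-*ˡ zero    c f = ℚP.*-zeroʳ c
Σ-*ˡ (suc n) c f = trans (ℚP.*-distribˡ-+ c (sumBelow n f) (f n)) (cong (_+ (c * f n)) (Σ-*ˡ n c f))

Σ-*ʳ : ∀ n c (f : ℕ → ℚ) → sumBelow n f * c ≡ sumBelow n (λ i → f i * c)
Σ-*ʳ n c f = trans (ℚP.*-comm _ c) (trans (Σ-*ˡ n c f) (Σ-cong′ n (λ i → ℚP.*-comm c (f i))))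

Σ-neg : ∀ n (f : ℕ → ℚ) → - sumBelow n f ≡ sumBelow n (λ i → - f i)
Σ-neg zero    f = refl
Σ-neg (suc n) f = trans (ℚP.neg-distrib-+ (sumBelow n f) (f n)) (cong (_+ (- f n)) (Σ-neg n f))

Σ-shift : ∀ n (f : ℕ → ℚ) → sumBelow (suc n) f ≡ f 0 + sumBelow n (λ i → f (suc i))
Σ-shift zero    f = trans (ℚP.+-identityˡ (f 0)) (sym (ℚP.+-identityʳ (f 0)))
Σ-shift (suc n) f = trans (cong (_+ f (suc n)) (Σ-shift n f)) (ℚP.+-assoc (f 0) _ _)

Σ-swap : ∀ a b (f : ℕ → ℕ → ℚ) →
         sumBelow a (λ i → sumBelow b (f i)) ≡ sumBelow b (λ j → sumBelow a (λ i → f i j))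
Σ-swap zero    b f = sym (Σ-0 b (λ _ _ → refl))
Σ-swap (suc a) b f = trans (cong (_+ sumBelow b (f a)) (Σ-swap a b f))
  (sym (Σ-+ b (λ j → sumBelow a (λ i → f i j)) (f a)))

Σ-split : ∀ a b (f : ℕ → ℚ) → sumBelow (a ℕ.+ b) f ≡ sumBelow a f + sumBelow b (λ x → f (a ℕ.+ x))
Σ-split a zero    f rewrite ℕP.+-identityʳ a = sym (ℚP.+-identityʳ _)
Σ-split a (suc b) f rewrite ℕP.+-suc a b =
  trans (cong (_+ f (a ℕ.+ b)) (Σ-split a b f)) (ℚP.+-assoc (sumBelow a f) _ (f (a ℕ.+ b)))

Σ-extend : ∀ a b (f : ℕ → ℚ) → a ≤ b → (∀ i → a ≤ i → f i ≡ 0ℚ) → sumBelow a f ≡ sumBelow b f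
Σ-extend a zero    f z≤n h = refl
Σ-extend a (suc b) f a≤ h with ℕP.m≤n⇒m<n∨m≡n a≤
... | inj₂ refl       = refl
... | inj₁ (s≤s a≤b) = trans (Σ-extend a b f a≤b h)
                          (sym (trans (cong (λ z → sumBelow b f + z) (h b a≤b)) (ℚP.+-identityʳ _)))

-- Formal power series

infix 4 _≈_
_≈_ : FPS → FPS → Set
A ≈ B = ∀ n → A n ≡ B n

≈-setoid : Setoid _ _
≈-setoid = record
  { Carrier       = FPS
  ; _≈_           = _≈_
  ; isEquivalence = record { refl = λ _ → refl ; sym = λ e n → sym (e n) ; trans = λ e f n → trans (e n) (f n) }
  }

open Setoid ≈-setoid public using () renaming (refl to ≈-refl; sym to ≈-sym; trans to ≈-trans)
module ≈-Reasoning = SetoidReasoning ≈-setoid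

∂ : FPS → FPS
∂ A n = fromℕ (suc n) * A (suc n)

*S-cong : ∀ {A A′ B B′} → A ≈ A′ → B ≈ B′ → A *S B ≈ A′ *S B′
*S-cong eA eB n = Σ-cong′ (suc n) (λ i → cong₂ _*_ (eA i) (eB (n ∸ i)))

*S-congˡ : ∀ {A A′} B → A ≈ A′ → A *S B ≈ A′ *S B
*S-congˡ B eA = *S-cong {B = B} eA ≈-refl

*S-congʳ : ∀ A {B B′} → B ≈ B′ → A *S B ≈ A *S B′
*S-congʳ A eB = *S-cong {A = A} ≈-refl eB

+S-cong : ∀ {A A′ B B′} → A ≈ A′ → B ≈ B′ → A +S B ≈ A′ +S B′
+S-cong eA eB n = cong₂ _+_ (eA n) (eB n)

∂-cong : ∀ {A A′} → A ≈ A′ → ∂ A ≈ ∂ A′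
∂-cong e n = cong (fromℕ (suc n) *_) (e (suc n))

intS-cong : ∀ {A A′} → A ≈ A′ → intS A ≈ intS A′
intS-cong e zero    = refl
intS-cong e (suc n) = cong ((+ 1 / suc n) *_) (e n)

shiftS-cong : ∀ v {A A′} → A ≈ A′ → shiftS v A ≈ shiftS v A′
shiftS-cong v e n = e (v ℕ.+ n)

powS-cong : ∀ {A A′} k → A ≈ A′ → powS A k ≈ powS A′ k
powS-cong zero    e = ≈-refl
powS-cong (suc k) e = *S-cong e (powS-cong k e)

*S-0 : ∀ A B → (A *S B) 0 ≡ A 0 * B 0
*S-0 A B = ℚP.+-identityˡ (A 0 * B 0)

*S-distribˡ : ∀ A B C → A *S (B +S C) ≈ (A *S B) +S (A *S C)
*S-distribˡ A B C n = trans (Σ-cong′ (suc n) (λ i → ℚP.*-distribˡ-+ (A i) (B (n ∸ i)) (C (n ∸ i))))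
  (Σ-+ (suc n) _ _)

*S-distribʳ : ∀ A B C → (A +S B) *S C ≈ (A *S C) +S (B *S C)
*S-distribʳ A B C n = trans (Σ-cong′ (suc n) (λ i → ℚP.*-distribʳ-+ (C (n ∸ i)) (A i) (B i)))
  (Σ-+ (suc n) _ _)

*S-scaleˡ : ∀ c A B → scaleS c A *S B ≈ scaleS c (A *S B)
*S-scaleˡ c A B n = trans (Σ-cong′ (suc n) (λ i → ℚP.*-assoc c (A i) (B (n ∸ i))))
  (sym (Σ-*ˡ (suc n) c _))

*S-scaleʳ : ∀ c A B → A *S scaleS c B ≈ scaleS c (A *S B)
*S-scaleʳ c A B n = trans (Σ-cong′ (suc n) (λ i → x*yz≡y*xz (A i) c (B (n ∸ i))))
  (sym (Σ-*ˡ (suc n) c _))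

*S-negˡ : ∀ A B → negS A *S B ≈ negS (A *S B)
*S-negˡ A B n = trans (Σ-cong′ (suc n) (λ i → sym (ℚP.neg-distribˡ-* (A i) (B (n ∸ i)))))
  (sym (Σ-neg (suc n) _))

*S-zeroʳ : ∀ A → A *S zeroS ≈ zeroS
*S-zeroʳ A n = Σ-0 (suc n) (λ i _ → ℚP.*-zeroʳ (A i))

*S-identityˡ : ∀ A → oneS *S A ≈ A
*S-identityˡ A n = begin
  sumBelow (suc n) (λ i → oneS i * A (n ∸ i))           ≡⟨ Σ-shift n _ ⟩
  1ℚ * A n + sumBelow n (λ i → 0ℚ * A (n ∸ suc i))      ≡⟨ cong₂ _+_ (ℚP.*-identityˡ (A n))
                                                             (Σ-0 n (λ i _ → ℚP.*-zeroˡ (A (n ∸ suc i)))) ⟩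
  A n + 0ℚ                                              ≡⟨ ℚP.+-identityʳ (A n) ⟩
  A n                                                   ∎
  where open ≡-Reasoning

∂-scaleS : ∀ c A → ∂ (scaleS c A) ≈ scaleS c (∂ A)
∂-scaleS c A n = x*yz≡y*xz (fromℕ (suc n)) c (A (suc n))

∂-oneS : ∂ oneS ≈ zeroS
∂-oneS n = ℚP.*-zeroʳ (fromℕ (suc n))

coeff-suc : ∀ X n → X (suc n) ≡ (+ 1 / suc n) * ∂ X n
coeff-suc X n = sym (begin
  (+ 1 / suc n) * (fromℕ (suc n) * X (suc n))  ≡⟨ sym (ℚP.*-assoc (+ 1 / suc n) (fromℕ (suc n)) (X (suc n))) ⟩
  ((+ 1 / suc n) * fromℕ (suc n)) * X (suc n)  ≡⟨ cong (_* X (suc n)) (1/n*n≡1 (suc n)) ⟩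
  1ℚ * X (suc n)                               ≡⟨ ℚP.*-identityˡ _ ⟩
  X (suc n)                                    ∎)
  where open ≡-Reasoning

fromℕ-!*∂ : ∀ X n → fromℕ (n !) * ∂ X n ≡ fromℕ (suc n !) * X (suc n)
fromℕ-!*∂ X n = begin
  fromℕ (n !) * (fromℕ (suc n) * X (suc n))  ≡⟨ sym (ℚP.*-assoc (fromℕ (n !)) (fromℕ (suc n)) (X (suc n))) ⟩
  (fromℕ (n !) * fromℕ (suc n)) * X (suc n)  ≡⟨ cong (_* X (suc n)) (ℚP.*-comm (fromℕ (n !)) (fromℕ (suc n))) ⟩
  (fromℕ (suc n) * fromℕ (n !)) * X (suc n)  ≡⟨ cong (_* X (suc n)) (sym (fromℕ-* (suc n) (n !))) ⟩
  fromℕ (suc n !) * X (suc n)                ∎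
  where open ≡-Reasoning

∂-*S : ∀ A B → ∂ (A *S B) ≈ (∂ A *S B) +S (A *S ∂ B)
∂-*S A B n = begin
  fromℕ (suc n) * sumBelow (suc (suc n)) f                ≡⟨ Σ-*ˡ (suc (suc n)) (fromℕ (suc n)) f ⟩
  sumBelow (suc (suc n)) (λ i → fromℕ (suc n) * f i)     ≡⟨ Σ-cong (suc (suc n)) split ⟩
  sumBelow (suc (suc n)) (λ i → left i + right i)        ≡⟨ Σ-+ (suc (suc n)) left right ⟩
  sumBelow (suc (suc n)) left + sumBelow (suc (suc n)) right ≡⟨ cong₂ _+_ left-sum right-sum ⟩
  (∂ A *S B) n + (A *S ∂ B) n                             ∎
  where
  open ≡-Reasoning
  f left right : ℕ → ℚ
  f i = A i * B (suc n ∸ i)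
  left i = fromℕ i * f i
  right i = fromℕ (suc n ∸ i) * f i
  split : ∀ i → i < suc (suc n) → fromℕ (suc n) * f i ≡ left i + right i
  split i (s≤s i≤) = trans (cong (λ z → fromℕ z * f i) (sym (ℕP.m+[n∸m]≡n i≤)))
    (trans (cong (_* f i) (fromℕ-+ i (suc n ∸ i))) (ℚP.*-distribʳ-+ (f i) (fromℕ i) (fromℕ (suc n ∸ i))))
  left-sum : sumBelow (suc (suc n)) left ≡ (∂ A *S B) n
  left-sum = begin
    sumBelow (suc (suc n)) left                      ≡⟨ Σ-shift (suc n) left ⟩
    left 0 + sumBelow (suc n) (λ i → left (suc i))   ≡⟨ cong (_+ sumBelow (suc n) (λ i → left (suc i))) (ℚP.*-zeroˡ (f 0)) ⟩
    0ℚ + sumBelow (suc n) (λ i → left (suc i))       ≡⟨ ℚP.+-identityˡ _ ⟩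
    sumBelow (suc n) (λ i → left (suc i))            ≡⟨ Σ-cong′ (suc n) (λ i → sym (ℚP.*-assoc (fromℕ (suc i)) (A (suc i)) (B (n ∸ i)))) ⟩
    (∂ A *S B) n                                     ∎
  right-sum : sumBelow (suc (suc n)) right ≡ (A *S ∂ B) n
  right-sum = begin
    sumBelow (suc n) right + right (suc n) ≡⟨ cong (λ w → sumBelow (suc n) right + w)
                                                (trans (cong (λ z → fromℕ z * f (suc n)) (ℕP.n∸n≡0 n)) (ℚP.*-zeroˡ (f (suc n)))) ⟩
    sumBelow (suc n) right + 0ℚ            ≡⟨ ℚP.+-identityʳ _ ⟩
    sumBelow (suc n) right                 ≡⟨ Σ-cong (suc n) (λ i i<n → trans
                                                (cong (λ z → fromℕ z * (A i * B z)) (ℕP.+-∸-assoc 1 (ℕP.≤-pred i<n)))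
                                                (x*yz≡y*xz (fromℕ (suc (n ∸ i))) (A i) (B (suc (n ∸ i))))) ⟩
    (A *S ∂ B) n                           ∎

-- A coefficient of index n+1 is determined by the derivative, so ring laws for *S
-- follow from the Leibniz rule by induction on the coefficient index.

*S-comm : ∀ A B → A *S B ≈ B *S A
*S-comm A B zero    = cong (λ w → 0ℚ + w) (ℚP.*-comm (A 0) (B 0))
*S-comm A B (suc n) = begin
  (A *S B) (suc n)                    ≡⟨ coeff-suc (A *S B) n ⟩
  r * ∂ (A *S B) n                    ≡⟨ cong (r *_) (∂-*S A B n) ⟩
  r * ((∂ A *S B) n + (A *S ∂ B) n)   ≡⟨ cong (r *_) (cong₂ _+_ (*S-comm (∂ A) B n) (*S-comm A (∂ B) n)) ⟩
  r * ((B *S ∂ A) n + (∂ B *S A) n)   ≡⟨ cong (r *_) (ℚP.+-comm ((B *S ∂ A) n) ((∂ B *S A) n)) ⟩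
  r * ((∂ B *S A) n + (B *S ∂ A) n)   ≡⟨ cong (r *_) (sym (∂-*S B A n)) ⟩
  r * ∂ (B *S A) n                    ≡⟨ sym (coeff-suc (B *S A) n) ⟩
  (B *S A) (suc n)                    ∎
  where
  open ≡-Reasoning
  r = + 1 / suc n

*S-assoc : ∀ A B C → (A *S B) *S C ≈ A *S (B *S C)
*S-assoc A B C zero = begin
  ((A *S B) *S C) 0   ≡⟨ *S-0 (A *S B) C ⟩
  (A *S B) 0 * C 0    ≡⟨ cong (_* C 0) (*S-0 A B) ⟩
  (A 0 * B 0) * C 0   ≡⟨ ℚP.*-assoc (A 0) (B 0) (C 0) ⟩
  A 0 * (B 0 * C 0)   ≡⟨ cong (A 0 *_) (sym (*S-0 B C)) ⟩
  A 0 * (B *S C) 0    ≡⟨ sym (*S-0 A (B *S C)) ⟩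
  (A *S (B *S C)) 0   ∎
  where open ≡-Reasoning
*S-assoc A B C (suc n) = begin
  ((A *S B) *S C) (suc n)  ≡⟨ coeff-suc ((A *S B) *S C) n ⟩
  r * ∂ ((A *S B) *S C) n  ≡⟨ cong (r *_) ∂-left ⟩
  r * ((x + y) + z)        ≡⟨ cong (r *_) (ℚP.+-assoc x y z) ⟩
  r * (x + (y + z))        ≡⟨ cong (r *_) (sym ∂-right) ⟩
  r * ∂ (A *S (B *S C)) n  ≡⟨ sym (coeff-suc (A *S (B *S C)) n) ⟩
  (A *S (B *S C)) (suc n)  ∎
  where
  open ≡-Reasoning
  r = + 1 / suc n
  x = (∂ A *S (B *S C)) n
  y = (A *S (∂ B *S C)) n
  z = (A *S (B *S ∂ C)) n
  ∂-left : ∂ ((A *S B) *S C) n ≡ (x + y) + z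
  ∂-left = begin
    ∂ ((A *S B) *S C) n                                                   ≡⟨ ∂-*S (A *S B) C n ⟩
    (∂ (A *S B) *S C) n + ((A *S B) *S ∂ C) n                             ≡⟨ cong (_+ ((A *S B) *S ∂ C) n)
                                                                               (trans (*S-congˡ C (∂-*S A B) n) (*S-distribʳ (∂ A *S B) (A *S ∂ B) C n)) ⟩
    (((∂ A *S B) *S C) n + ((A *S ∂ B) *S C) n) + ((A *S B) *S ∂ C) n     ≡⟨ cong₂ _+_ (cong₂ _+_ (*S-assoc (∂ A) B C n) (*S-assoc A (∂ B) C n))
                                                                                           (*S-assoc A B (∂ C) n) ⟩
    (x + y) + z                                                           ∎
  ∂-right : ∂ (A *S (B *S C)) n ≡ x + (y + z)
  ∂-right = begin
    ∂ (A *S (B *S C)) n       ≡⟨ ∂-*S A (B *S C) n ⟩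
    x + (A *S ∂ (B *S C)) n   ≡⟨ cong (λ w → x + w) (trans (*S-congʳ A (∂-*S B C) n) (*S-distribˡ A (∂ B *S C) (B *S ∂ C) n)) ⟩
    x + (y + z)               ∎

*S-identityʳ : ∀ A → A *S oneS ≈ A
*S-identityʳ A = ≈-trans (*S-comm A oneS) (*S-identityˡ A)

*S-zeroˡ : ∀ A → zeroS *S A ≈ zeroS
*S-zeroˡ A = ≈-trans (*S-comm zeroS A) (*S-zeroʳ A)

∂-powS : ∀ A k → ∂ (powS A (suc k)) ≈ scaleS (fromℕ (suc k)) (powS A k *S ∂ A)
∂-powS A zero n = begin
  ∂ (A *S oneS) n                      ≡⟨ ∂-*S A oneS n ⟩
  (∂ A *S oneS) n + (A *S ∂ oneS) n    ≡⟨ cong₂ _+_ (*S-identityʳ (∂ A) n) (trans (*S-congʳ A ∂-oneS n) (*S-zeroʳ A n)) ⟩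
  ∂ A n + 0ℚ                           ≡⟨ ℚP.+-identityʳ _ ⟩
  ∂ A n                                ≡⟨ sym (*S-identityˡ (∂ A) n) ⟩
  (oneS *S ∂ A) n                      ≡⟨ sym (ℚP.*-identityˡ _) ⟩
  1ℚ * (oneS *S ∂ A) n                 ∎
  where open ≡-Reasoning
∂-powS A (suc k) n = begin
  ∂ (A *S powS A (suc k)) n                                  ≡⟨ ∂-*S A (powS A (suc k)) n ⟩
  (∂ A *S powS A (suc k)) n + (A *S ∂ (powS A (suc k))) n    ≡⟨ cong₂ _+_ (*S-comm (∂ A) (powS A (suc k)) n) inner ⟩
  X + c * X                                                  ≡⟨ solve 2 (λ x c → x :+ c :* x := (con 1ℚ :+ c) :* x) refl X c ⟩
  (1ℚ + c) * X                                               ≡⟨ cong (_* X) (sym (fromℕ-+ 1 (suc k))) ⟩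
  fromℕ (suc (suc k)) * X                                    ∎
  where
  open ≡-Reasoning
  c = fromℕ (suc k)
  X = (powS A (suc k) *S ∂ A) n
  inner : (A *S ∂ (powS A (suc k))) n ≡ c * X
  inner = begin
    (A *S ∂ (powS A (suc k))) n                 ≡⟨ *S-congʳ A (∂-powS A k) n ⟩
    (A *S scaleS c (powS A k *S ∂ A)) n         ≡⟨ *S-scaleʳ c A (powS A k *S ∂ A) n ⟩
    c * (A *S (powS A k *S ∂ A)) n              ≡⟨ cong (c *_) (sym (*S-assoc A (powS A k) (∂ A) n)) ⟩
    c * X                                       ∎

VanishesBelow : ℕ → FPS → Set
VanishesBelow v A = ∀ j → j < v → A j ≡ 0ℚ

-- Σ_k c k · X k.  The n-th coefficient only sums over k ≤ n, so this is the genuine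
-- sum when X k vanishes below k.
sumS : (ℕ → ℚ) → (ℕ → FPS) → FPS
sumS c X n = sumTo n (λ k → c k * X k n)

powS-vanishesBelow : ∀ A → A 0 ≡ 0ℚ → ∀ k → VanishesBelow k (powS A k)
powS-vanishesBelow A A0 zero    j ()
powS-vanishesBelow A A0 (suc k) j j<k = Σ-0 (suc j) term
  where
  term : ∀ i → i < suc j → A i * powS A k (j ∸ i) ≡ 0ℚ
  term zero    _ = trans (cong (_* powS A k j) A0) (ℚP.*-zeroˡ (powS A k j))
  term (suc i) (s≤s i≤j) = trans (cong (A (suc i) *_)
                                   (powS-vanishesBelow A A0 k (j ∸ suc i) (ℕP.<-≤-trans (ℕP.∸-monoʳ-< (s≤s z≤n) i≤j) (ℕP.≤-pred j<k))))
                                 (ℚP.*-zeroʳ (A (suc i)))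

*S-sumS : ∀ A c X → (∀ k → VanishesBelow k (X k)) → A *S sumS c X ≈ sumS c (λ k → A *S X k)
*S-sumS A c X vanish n = begin
  sumBelow (suc n) (λ i → A i * sumBelow (suc (n ∸ i)) (λ k → c k * X k (n ∸ i)))
    ≡⟨ Σ-cong′ (suc n) (λ i → cong (A i *_) (Σ-extend (suc (n ∸ i)) (suc n) _ (s≤s (ℕP.m∸n≤m n i))
         (λ k le → trans (cong (c k *_) (vanish k (n ∸ i) le)) (ℚP.*-zeroʳ (c k))))) ⟩
  sumBelow (suc n) (λ i → A i * sumBelow (suc n) (λ k → c k * X k (n ∸ i)))
    ≡⟨ Σ-cong′ (suc n) (λ i → Σ-*ˡ (suc n) (A i) (λ k → c k * X k (n ∸ i))) ⟩
  sumBelow (suc n) (λ i → sumBelow (suc n) (λ k → A i * (c k * X k (n ∸ i))))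
    ≡⟨ Σ-swap (suc n) (suc n) (λ i k → A i * (c k * X k (n ∸ i))) ⟩
  sumBelow (suc n) (λ k → sumBelow (suc n) (λ i → A i * (c k * X k (n ∸ i))))
    ≡⟨ Σ-cong′ (suc n) (λ k → trans (Σ-cong′ (suc n) (λ i → x*yz≡y*xz (A i) (c k) (X k (n ∸ i))))
                                     (sym (Σ-*ˡ (suc n) (c k) (λ i → A i * X k (n ∸ i))))) ⟩
  sumS c (λ k → A *S X k) n
    ∎
  where open ≡-Reasoning

∂-sumS : ∀ c X → (∀ k → VanishesBelow (suc k) (X k)) → ∂ (sumS c X) ≈ sumS c (λ k → ∂ (X k))
∂-sumS c X vanish n = begin
  fromℕ (suc n) * (sumBelow (suc n) f + c (suc n) * X (suc n) (suc n))
    ≡⟨ cong (λ z → fromℕ (suc n) * (sumBelow (suc n) f + z))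
         (trans (cong (c (suc n) *_) (vanish (suc n) (suc n) ℕP.≤-refl)) (ℚP.*-zeroʳ (c (suc n)))) ⟩
  fromℕ (suc n) * (sumBelow (suc n) f + 0ℚ)                ≡⟨ cong (fromℕ (suc n) *_) (ℚP.+-identityʳ _) ⟩
  fromℕ (suc n) * sumBelow (suc n) f                       ≡⟨ Σ-*ˡ (suc n) (fromℕ (suc n)) f ⟩
  sumBelow (suc n) (λ k → fromℕ (suc n) * (c k * X k (suc n)))
    ≡⟨ Σ-cong′ (suc n) (λ k → x*yz≡y*xz (fromℕ (suc n)) (c k) (X k (suc n))) ⟩
  sumS c (λ k → ∂ (X k)) n                                 ∎
  where
  open ≡-Reasoning
  f = λ k → c k * X k (suc n)

intS-unique : ∀ X Y → Y 0 ≡ 0ℚ → ∂ Y ≈ X → intS X ≈ Y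
intS-unique X Y Y0 ∂Y zero    = sym Y0
intS-unique X Y Y0 ∂Y (suc n) = trans (cong ((+ 1 / suc n) *_) (sym (∂Y n))) (sym (coeff-suc Y n))

recip-inverseˡ : ∀ c → c ≢ 0ℚ → recip c * c ≡ 1ℚ
recip-inverseˡ c c≢0 with c ℚP.≟ 0ℚ
... | yes c≡0  = ⊥-elim (c≢0 c≡0)
... | no  c≢0′ = ℚP.*-inverseˡ c {{ℚ.≢-nonZero c≢0′}}

-- With Q = 1 − A/A(0), the sum Σ_k Q^k telescopes against (1 − Q) Σ_k Q^k.
*S-invS : ∀ A → A 0 ≢ 0ℚ → A *S invS A ≈ oneS
*S-invS A A0≢0 n = begin
  (A *S invS A) n                    ≡⟨ *S-congʳ A invS≈ n ⟩
  (A *S scaleS r G) n                ≡⟨ *S-scaleʳ r A G n ⟩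
  r * (A *S G) n                     ≡⟨ sym (*S-scaleˡ r A G n) ⟩
  (scaleS r A *S G) n                ≡⟨ *S-congˡ G rA≈1-Q n ⟩
  ((oneS +S negS Q) *S G) n          ≡⟨ *S-distribʳ oneS (negS Q) G n ⟩
  (oneS *S G) n + (negS Q *S G) n    ≡⟨ cong₂ _+_ (*S-identityˡ G n)
                                          (trans (*S-negˡ Q G n) (cong -_ (*S-sumS Q (λ _ → 1ℚ) (powS Q) (powS-vanishesBelow Q Q0) n))) ⟩
  G n + - sumS (λ _ → 1ℚ) (λ k → powS Q (suc k)) n ≡⟨ telescope ⟩
  oneS n                             ∎
  where
  open ≡-Reasoning
  r = recip (A 0)
  Q = oneS -S scaleS r A
  G = sumS (λ _ → 1ℚ) (powS Q)
  Q0 : Q 0 ≡ 0ℚ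
  Q0 = cong (λ z → 1ℚ + - z) (recip-inverseˡ (A 0) A0≢0)
  invS≈ : invS A ≈ scaleS r G
  invS≈ m = cong (r *_) (Σ-cong′ (suc m) (λ k → sym (ℚP.*-identityˡ _)))
  rA≈1-Q : scaleS r A ≈ oneS +S negS Q
  rA≈1-Q m = solve 2 (λ o x → x := o :+ (:- (o :+ (:- x)))) refl (oneS m) (r * A m)
  S = sumBelow n (λ k → 1ℚ * powS Q (suc k) n)
  telescope : G n + - sumS (λ _ → 1ℚ) (λ k → powS Q (suc k)) n ≡ oneS n
  telescope = begin
    G n + - (S + 1ℚ * powS Q (suc n) n)    ≡⟨ cong₂ (λ a b → a + - (S + 1ℚ * b)) (Σ-shift n _) (powS-vanishesBelow Q Q0 (suc n) n ℕP.≤-refl) ⟩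
    (1ℚ * oneS n + S) + - (S + 1ℚ * 0ℚ)   ≡⟨ solve 2 (λ o s → (con 1ℚ :* o :+ s) :+ (:- (s :+ con 1ℚ :* con 0ℚ)) := o) refl (oneS n) S ⟩
    oneS n                                 ∎

shiftS-*S : ∀ v A Y → VanishesBelow v A → shiftS v (A *S Y) ≈ shiftS v A *S Y
shiftS-*S v A Y vanish n = begin
  sumBelow (suc (v ℕ.+ n)) f
    ≡⟨ cong (λ z → sumBelow z f) (sym (ℕP.+-suc v n)) ⟩
  sumBelow (v ℕ.+ suc n) f
    ≡⟨ Σ-split v (suc n) f ⟩
  sumBelow v f + sumBelow (suc n) (λ x → A (v ℕ.+ x) * Y (v ℕ.+ n ∸ (v ℕ.+ x)))
    ≡⟨ cong₂ _+_ (Σ-0 v (λ i i<v → trans (cong (_* Y (v ℕ.+ n ∸ i)) (vanish i i<v)) (ℚP.*-zeroˡ (Y (v ℕ.+ n ∸ i)))))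
                 (Σ-cong′ (suc n) (λ x → cong (λ z → A (v ℕ.+ x) * Y z) (ℕP.[m+n]∸[m+o]≡n∸o v n x))) ⟩
  0ℚ + (shiftS v A *S Y) n
    ≡⟨ ℚP.+-identityˡ _ ⟩
  (shiftS v A *S Y) n
    ∎
  where
  open ≡-Reasoning
  f = λ i → A i * Y (v ℕ.+ n ∸ i)

divS-exact : ∀ v u X Y → VanishesBelow v u → u v ≢ 0ℚ → X ≈ u *S Y → divS v X u ≈ Y
divS-exact v u X Y vanish uv≢0 X≈uY = begin
  shiftS v X *S invS (shiftS v u)             ≈⟨ *S-congˡ (invS (shiftS v u)) (≈-trans (shiftS-cong v X≈uY) (shiftS-*S v u Y vanish)) ⟩
  (shiftS v u *S Y) *S invS (shiftS v u)      ≈⟨ *S-congˡ (invS (shiftS v u)) (*S-comm (shiftS v u) Y) ⟩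
  (Y *S shiftS v u) *S invS (shiftS v u)      ≈⟨ *S-assoc Y (shiftS v u) (invS (shiftS v u)) ⟩
  Y *S (shiftS v u *S invS (shiftS v u))      ≈⟨ *S-congʳ Y (*S-invS (shiftS v u) (λ e → uv≢0 (trans (cong u (sym (ℕP.+-identityʳ v))) e))) ⟩
  Y *S oneS                                   ≈⟨ *S-identityʳ Y ⟩
  Y                                           ∎
  where open ≈-Reasoning

-- The iterated integrals

liCoeff : ℕ → ℕ → ℚ
liCoeff μ k = (+ 1 / (suc k ^ μ)) {{ℕP.m^n≢0 (suc k) μ}}

-- Σ_k u^k / (k+1)^μ, that is Li_μ(u) / u
liS : ℕ → FPS → FPS
liS μ u = sumS (liCoeff μ) (powS u)

liCoeff-suc*suc : ∀ μ k → liCoeff (suc μ) k * fromℕ (suc k) ≡ liCoeff μ k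
liCoeff-suc*suc μ k = trans (/-*-/ 1 (suc k) (suc k ^ suc μ) 1 {{ℕP.m^n≢0 (suc k) (suc μ)}})
  (/-cross (1 ℕ.* suc k) 1 (suc k ^ suc μ ℕ.* 1) (suc k ^ μ)
    {{ℕP.m*n≢0 (suc k ^ suc μ) 1 {{ℕP.m^n≢0 (suc k) (suc μ)}}}} {{ℕP.m^n≢0 (suc k) μ}}
    (trans (cong (ℕ._* (suc k ^ μ)) (ℕP.*-identityˡ (suc k)))
           (sym (trans (ℕP.*-identityˡ _) (ℕP.*-identityʳ _)))))

liCoeff-1 : ∀ k → liCoeff 1 k ≡ + 1 / suc k
liCoeff-1 k = /-cross 1 1 (suc k ^ 1) (suc k) {{ℕP.m^n≢0 (suc k) 1}}
  (cong (1 ℕ.*_) (sym (ℕP.*-identityʳ (suc k))))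

powS-negS : ∀ A k → powS (negS A) k ≈ scaleS (sign k) (powS A k)
powS-negS A zero    n = sym (ℚP.*-identityˡ (oneS n))
powS-negS A (suc k) n = begin
  (negS A *S powS (negS A) k) n              ≡⟨ *S-congʳ (negS A) (powS-negS A k) n ⟩
  (negS A *S scaleS (sign k) (powS A k)) n   ≡⟨ *S-scaleʳ (sign k) (negS A) (powS A k) n ⟩
  sign k * (negS A *S powS A k) n            ≡⟨ cong (sign k *_) (*S-negˡ A (powS A k) n) ⟩
  sign k * - (A *S powS A k) n               ≡⟨ trans (sym (ℚP.neg-distribʳ-* (sign k) X)) (ℚP.neg-distribˡ-* (sign k) X) ⟩
  - sign k * (A *S powS A k) n               ∎
  where
  open ≡-Reasoning
  X = (A *S powS A k) n

*S-liS : ∀ μ u → u 0 ≡ 0ℚ → u *S liS μ u ≈ sumS (liCoeff μ) (λ k → powS u (suc k))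
*S-liS μ u u0 = *S-sumS u (liCoeff μ) (powS u) (powS-vanishesBelow u u0)

-logS≈*S-liS : ∀ W u → u 0 ≡ 0ℚ → W -S oneS ≈ negS u → negS (logS W) ≈ u *S liS 1 u
-logS≈*S-liS W u u0 W-1≈-u n = begin
  - sumBelow n (λ k → sign k * ((+ 1 / suc k) * powS (W -S oneS) (suc k) n)) ≡⟨ cong -_ (Σ-cong′ n term) ⟩
  - sumBelow n (λ k → - t k)                                                ≡⟨ Σ-neg n _ ⟩
  sumBelow n (λ k → - - t k)                                                ≡⟨ Σ-cong′ n (λ k → solve 1 (λ x → :- (:- x) := x) refl (t k)) ⟩
  sumBelow n t                                                              ≡⟨ sym (ℚP.+-identityʳ _) ⟩
  sumBelow n t + 0ℚ                                                         ≡⟨ cong (λ z → sumBelow n t + z) (sym t-n≡0) ⟩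
  sumS (liCoeff 1) (λ k → powS u (suc k)) n                                 ≡⟨ sym (*S-liS 1 u u0 n) ⟩
  (u *S liS 1 u) n                                                          ∎
  where
  open ≡-Reasoning
  t : ℕ → ℚ
  t k = liCoeff 1 k * powS u (suc k) n
  t-n≡0 : t n ≡ 0ℚ
  t-n≡0 = trans (cong (liCoeff 1 n *_) (powS-vanishesBelow u u0 (suc n) n ℕP.≤-refl)) (ℚP.*-zeroʳ (liCoeff 1 n))
  term : ∀ k → sign k * ((+ 1 / suc k) * powS (W -S oneS) (suc k) n) ≡ - t k
  term k = begin
    sign k * ((+ 1 / suc k) * powS (W -S oneS) (suc k) n)
      ≡⟨ cong (λ z → sign k * ((+ 1 / suc k) * z)) (trans (powS-cong (suc k) W-1≈-u n) (powS-negS u (suc k) n)) ⟩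
    sign k * ((+ 1 / suc k) * (- sign k * powS u (suc k) n))
      ≡⟨ solve 3 (λ s q x → s :* (q :* ((:- s) :* x)) := :- ((s :* s) :* (q :* x))) refl (sign k) (+ 1 / suc k) (powS u (suc k) n) ⟩
    - ((sign k * sign k) * ((+ 1 / suc k) * powS u (suc k) n))
      ≡⟨ cong (λ z → - (z * ((+ 1 / suc k) * powS u (suc k) n))) (sign*sign≡1 k) ⟩
    - (1ℚ * ((+ 1 / suc k) * powS u (suc k) n))
      ≡⟨ cong -_ (trans (ℚP.*-identityˡ _) (cong (_* powS u (suc k) n) (sym (liCoeff-1 k)))) ⟩
    - t k
      ∎

∂-*S-liS : ∀ μ u → u 0 ≡ 0ℚ → ∂ (u *S liS (suc μ) u) ≈ ∂ u *S liS μ u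
∂-*S-liS μ u u0 = begin
  ∂ (u *S liS (suc μ) u)                               ≈⟨ ∂-cong (*S-liS (suc μ) u u0) ⟩
  ∂ (sumS (liCoeff (suc μ)) (λ k → powS u (suc k)))    ≈⟨ ∂-sumS (liCoeff (suc μ)) (λ k → powS u (suc k)) (λ k → powS-vanishesBelow u u0 (suc k)) ⟩
  sumS (liCoeff (suc μ)) (λ k → ∂ (powS u (suc k)))    ≈⟨ (λ n → Σ-cong′ (suc n) (termwise n)) ⟩
  sumS (liCoeff μ) (λ k → ∂ u *S powS u k)             ≈⟨ ≈-sym (*S-sumS (∂ u) (liCoeff μ) (powS u) (powS-vanishesBelow u u0)) ⟩
  ∂ u *S liS μ u                                       ∎
  where
  open ≈-Reasoning
  termwise : ∀ n k → liCoeff (suc μ) k * ∂ (powS u (suc k)) n ≡ liCoeff μ k * (∂ u *S powS u k) n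
  termwise n k = trans (cong (liCoeff (suc μ) k *_) (∂-powS u k n))
    (trans (sym (ℚP.*-assoc (liCoeff (suc μ) k) (fromℕ (suc k)) _))
           (cong₂ _*_ (liCoeff-suc*suc μ k) (*S-comm (powS u k) (∂ u) n)))

intS-∂*S-liS : ∀ μ u → u 0 ≡ 0ℚ → intS (∂ u *S liS μ u) ≈ u *S liS (suc μ) u
intS-∂*S-liS μ u u0 = intS-unique _ _ Y0 (∂-*S-liS μ u u0)
  where
  Y0 : (u *S liS (suc μ) u) 0 ≡ 0ℚ
  Y0 = trans (*S-0 u (liS (suc μ) u)) (trans (cong (_* liS (suc μ) u 0) u0) (ℚP.*-zeroˡ (liS (suc μ) u 0)))

module IteratedIntegral
  (v : ℕ) (u d W : FPS) (H : ℕ → FPS)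
  (1≤v : 1 ≤ v) (u-vanishes : VanishesBelow v u) (u-lead≢0 : u v ≢ 0ℚ)
  (∂u≈d : ∂ u ≈ d) (W-1≈-u : W -S oneS ≈ negS u)
  (H-one : H 1 ≈ negS (logS W))
  (H-suc : ∀ j → H (suc (suc j)) ≈ intS (divS v (d *S H (suc j)) u))
  where

  H≈*S-liS : ∀ j → H (suc j) ≈ u *S liS (suc j) u
  H≈*S-liS zero    = ≈-trans H-one (-logS≈*S-liS W u (u-vanishes 0 1≤v) W-1≈-u)
  H≈*S-liS (suc j) = begin
    H (suc (suc j))                   ≈⟨ H-suc j ⟩
    intS (divS v (d *S H (suc j)) u)  ≈⟨ intS-cong (divS-exact v u _ (d *S L) u-vanishes u-lead≢0 dH≈u[dL]) ⟩
    intS (d *S L)                     ≈⟨ intS-cong (*S-congˡ L (≈-sym ∂u≈d)) ⟩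
    intS (∂ u *S L)                   ≈⟨ intS-∂*S-liS (suc j) u (u-vanishes 0 1≤v) ⟩
    u *S liS (suc (suc j)) u          ∎
    where
    open ≈-Reasoning
    L = liS (suc j) u
    dH≈u[dL] : d *S H (suc j) ≈ u *S (d *S L)
    dH≈u[dL] = begin
      d *S H (suc j)   ≈⟨ *S-congʳ d (H≈*S-liS j) ⟩
      d *S (u *S L)    ≈⟨ ≈-sym (*S-assoc d u L) ⟩
      (d *S u) *S L    ≈⟨ *S-congˡ L (*S-comm d u) ⟩
      (u *S d) *S L    ≈⟨ *S-assoc u d L ⟩
      u *S (d *S L)    ∎

  divS-H≈liS : ∀ μ → 1 ≤ μ → divS v (H μ) u ≈ liS μ u
  divS-H≈liS (suc j) _ = divS-exact v u (H (suc j)) (liS (suc j) u) u-vanishes u-lead≢0 (H≈*S-liS j)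

-- Counting set partitions

𝟙 : Bool → ℚ
𝟙 b = if b then 1ℚ else 0ℚ

𝟙*𝟙 : ∀ a b → 𝟙 a * 𝟙 b ≡ 𝟙 (b ∧ a)
𝟙*𝟙 a true  = ℚP.*-identityʳ (𝟙 a)
𝟙*𝟙 a false = ℚP.*-zeroʳ (𝟙 a)

countℚ : {A : Set} → (A → Bool) → List A → ℚ
countℚ f xs = fromℕ (countIf f xs)

countℚ-∷ : ∀ {A : Set} (f : A → Bool) x xs → countℚ f (x ∷ xs) ≡ 𝟙 (f x) + countℚ f xs
countℚ-∷ f x xs with f x
... | true  = fromℕ-+ 1 (countIf f xs)
... | false = sym (ℚP.+-identityˡ (countℚ f xs))

countℚ-[_] : ∀ {A : Set} x (f : A → Bool) → countℚ f (x ∷ []) ≡ 𝟙 (f x)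
countℚ-[ x ] f with f x
... | true  = refl
... | false = refl

countIf-++ : ∀ {A : Set} (f : A → Bool) xs ys → countIf f (xs ++ ys) ≡ countIf f xs ℕ.+ countIf f ys
countIf-++ f []       ys = refl
countIf-++ f (x ∷ xs) ys with f x
... | true  = cong suc (countIf-++ f xs ys)
... | false = countIf-++ f xs ys

countℚ-++ : ∀ {A : Set} (f : A → Bool) xs ys → countℚ f (xs ++ ys) ≡ countℚ f xs + countℚ f ys
countℚ-++ f xs ys = trans (cong fromℕ (countIf-++ f xs ys)) (fromℕ-+ (countIf f xs) (countIf f ys))

countIf-cong : ∀ {A : Set} {f g : A → Bool} xs → (∀ x → f x ≡ g x) → countIf f xs ≡ countIf g xs
countIf-cong []       h = refl
countIf-cong (x ∷ xs) h rewrite h x | countIf-cong xs h = refl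

countIf-false : ∀ {A : Set} (xs : List A) → countIf (λ _ → false) xs ≡ 0
countIf-false []       = refl
countIf-false (x ∷ xs) = countIf-false xs

countℚ-map-∷ : ∀ (f : List ℕ → Bool) w k (g : ℕ → ℕ) →
               countℚ f (map (λ x → x ∷ w) (applyUpTo g k)) ≡ sumBelow k (λ x → 𝟙 (f (g x ∷ w)))
countℚ-map-∷ f w zero    g = refl
countℚ-map-∷ f w (suc k) g = trans (countℚ-∷ f (g 0 ∷ w) (map (λ x → x ∷ w) (applyUpTo (λ x → g (suc x)) k)))
  (trans (cong (λ z → 𝟙 (f (g 0 ∷ w)) + z) (countℚ-map-∷ f w k (λ x → g (suc x))))
         (sym (Σ-shift k (λ x → 𝟙 (f (g x ∷ w))))))

countℚ-words-suc : ∀ (f : List ℕ → Bool) n k →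
                   countℚ f (words (suc n) k) ≡ sumBelow k (λ x → countℚ (λ w → f (x ∷ w)) (words n k))
countℚ-words-suc f n k = prepend (words n k)
  where
  open ≡-Reasoning
  prepend : ∀ ws → countℚ f (concatMap (λ w → map (λ x → x ∷ w) (upTo k)) ws)
                   ≡ sumBelow k (λ x → countℚ (λ w → f (x ∷ w)) ws)
  prepend []       = sym (Σ-0 k (λ _ _ → refl))
  prepend (w ∷ ws) = begin
    countℚ f (map (λ x → x ∷ w) (upTo k) ++ concatMap (λ w → map (λ x → x ∷ w) (upTo k)) ws)
      ≡⟨ countℚ-++ f (map (λ x → x ∷ w) (upTo k)) (concatMap (λ w → map (λ x → x ∷ w) (upTo k)) ws) ⟩
    countℚ f (map (λ x → x ∷ w) (upTo k)) + countℚ f (concatMap (λ w → map (λ x → x ∷ w) (upTo k)) ws)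
      ≡⟨ cong₂ _+_ (countℚ-map-∷ f w k (λ x → x)) (prepend ws) ⟩
    sumBelow k (λ x → 𝟙 (f (x ∷ w))) + sumBelow k (λ x → countℚ (λ w′ → f (x ∷ w′)) ws)
      ≡⟨ sym (Σ-+ k (λ x → 𝟙 (f (x ∷ w))) (λ x → countℚ (λ w′ → f (x ∷ w′)) ws)) ⟩
    sumBelow k (λ x → 𝟙 (f (x ∷ w)) + countℚ (λ w′ → f (x ∷ w′)) ws)
      ≡⟨ Σ-cong′ k (λ x → sym (countℚ-∷ (λ w′ → f (x ∷ w′)) w ws)) ⟩
    sumBelow k (λ x → countℚ (λ w′ → f (x ∷ w′)) (w ∷ ws))
      ∎

≡ᵇ-refl : ∀ x → (x ≡ᵇ x) ≡ true
≡ᵇ-refl x = Equivalence.to T-≡ (ℕP.≡⇒≡ᵇ x x refl)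

≢⇒≡ᵇ-false : ∀ {x y} → x ≢ y → (x ≡ᵇ y) ≡ false
≢⇒≡ᵇ-false {x} {y} x≢y with x ≡ᵇ y in eq
... | false = refl
... | true  = ⊥-elim (x≢y (ℕP.≡ᵇ⇒≡ x y (Equivalence.from T-≡ eq)))

≤⇒≤ᵇ-true : ∀ {x y} → x ≤ y → (x ≤ᵇ y) ≡ true
≤⇒≤ᵇ-true x≤y = Equivalence.to T-≡ (ℕP.≤⇒≤ᵇ x≤y)

>⇒≤ᵇ-false : ∀ {x y} → y < x → (x ≤ᵇ y) ≡ false
>⇒≤ᵇ-false {x} {y} y<x with x ≤ᵇ y in eq
... | false = refl
... | true  = ⊥-elim (ℕP.<⇒≱ y<x (ℕP.≤ᵇ⇒≤ x y (Equivalence.from T-≡ eq)))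

bump : (ℕ → ℕ) → ℕ → ℕ → ℕ
bump s x j = if x ≡ᵇ j then suc (s j) else s j

bump-same : ∀ s x → bump s x x ≡ suc (s x)
bump-same s x rewrite ≡ᵇ-refl x = refl

bump-other : ∀ s {x j} → x ≢ j → bump s x j ≡ s j
bump-other s x≢j rewrite ≢⇒≡ᵇ-false x≢j = refl

EmptyFrom : ℕ → (ℕ → ℕ) → Set
EmptyFrom c s = ∀ j → c ≤ j → s j ≡ 0

EmptyFrom-bump-< : ∀ {c s x} → x < c → EmptyFrom c s → EmptyFrom c (bump s x)
EmptyFrom-bump-< {s = s} x<c empty j c≤j = trans (bump-other s (λ e → ℕP.<-irrefl e (ℕP.<-≤-trans x<c c≤j))) (empty j c≤j)

EmptyFrom-bump-open : ∀ {c s} → EmptyFrom c s → EmptyFrom (suc c) (bump s c)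
EmptyFrom-bump-open {s = s} empty j c<j = trans (bump-other s (λ e → ℕP.<-irrefl e c<j)) (empty j (ℕP.<⇒≤ c<j))

blocksOK : (ℕ → Bool) → ℕ → (ℕ → ℕ) → List ℕ → Bool
blocksOK p zero    s w = true
blocksOK p (suc j) s w = p (s j ℕ.+ blockSize j w) ∧ blocksOK p j s w

blocksOK-∷ : ∀ p j s x w → blocksOK p j s (x ∷ w) ≡ blocksOK p j (bump s x) w
blocksOK-∷ p zero    s x w = refl
blocksOK-∷ p (suc j) s x w with x ≡ᵇ j
... | true  = cong₂ _∧_ (cong p (ℕP.+-suc (s j) (blockSize j w))) (blocksOK-∷ p j s x w)
... | false = cong (p (s j ℕ.+ blockSize j w) ∧_) (blocksOK-∷ p j s x w)

blocksOK-empty : ∀ p j w → blocksOK p j (λ _ → 0) w ≡ allBlocks p j w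
blocksOK-empty p zero    w = refl
blocksOK-empty p (suc j) w = cong (p (blockSize j w) ∧_) (blocksOK-empty p j w)

-- Words are read from the head, so #completions p k n c s counts the length-n suffixes
-- that complete a restricted growth word which has opened c of its k blocks, block j
-- already holding s j letters, into a partition whose block sizes all satisfy p.
#completions : (ℕ → Bool) → (k n c : ℕ) → (ℕ → ℕ) → ℚ
#completions p k n c s = countℚ (λ w → isRGS c w k ∧ blocksOK p k s w) (words n k)

#completionsWith : (ℕ → Bool) → (k n c : ℕ) → (ℕ → ℕ) → ℕ → ℚ
#completionsWith p k n c s x = countℚ (λ w → isRGS c (x ∷ w) k ∧ blocksOK p k s (x ∷ w)) (words n k)

#completionsWith≡ : ∀ p k n c s x → #completionsWith p k n c s x
                    ≡ (if x ≤ᵇ c then #completions p k n (if x ≡ᵇ c then suc c else c) (bump s x) else 0ℚ)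
#completionsWith≡ p k n c s x with x ≤ᵇ c
... | true  = cong fromℕ (countIf-cong (words n k)
                (λ w → cong (isRGS (if x ≡ᵇ c then suc c else c) w k ∧_) (blocksOK-∷ p k s x w)))
... | false = cong fromℕ (countIf-false (words n k))

#completionsWith-< : ∀ p k n c s x → x < c → #completionsWith p k n c s x ≡ #completions p k n c (bump s x)
#completionsWith-< p k n c s x x<c = trans (#completionsWith≡ p k n c s x)
  (trans (if-cong (≤⇒≤ᵇ-true (ℕP.<⇒≤ x<c)))
         (cong (λ b → #completions p k n (if b then suc c else c) (bump s x)) (≢⇒≡ᵇ-false (ℕP.<⇒≢ x<c))))

#completionsWith-open : ∀ p k n c s → #completionsWith p k n c s c ≡ #completions p k n (suc c) (bump s c)
#completionsWith-open p k n c s = trans (#completionsWith≡ p k n c s c)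
  (trans (if-cong (≤⇒≤ᵇ-true (ℕP.≤-refl {c})))
         (cong (λ b → #completions p k n (if b then suc c else c) (bump s c)) (≡ᵇ-refl c)))

#completionsWith-> : ∀ p k n c s x → c < x → #completionsWith p k n c s x ≡ 0ℚ
#completionsWith-> p k n c s x c<x = trans (#completionsWith≡ p k n c s x) (if-cong (>⇒≤ᵇ-false c<x))

#opening : (ℕ → Bool) → (n c d : ℕ) → (ℕ → ℕ) → ℚ
#opening p n c zero    s = 0ℚ
#opening p n c (suc d) s = #completions p (c ℕ.+ suc d) n (suc c) (bump s c)

#completionsWith-≥ : ∀ p n c d s → sumBelow d (λ y → #completionsWith p (c ℕ.+ d) n c s (c ℕ.+ y)) ≡ #opening p n c d s
#completionsWith-≥ p n c zero    s = refl
#completionsWith-≥ p n c (suc d) s = begin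
  sumBelow (suc d) (λ y → F (c ℕ.+ y))                   ≡⟨ Σ-shift d (λ y → F (c ℕ.+ y)) ⟩
  F (c ℕ.+ 0) + sumBelow d (λ y → F (c ℕ.+ suc y))       ≡⟨ cong₂ _+_ (cong F (ℕP.+-identityʳ c))
                                                              (Σ-0 d (λ y _ → #completionsWith-> p k n c s (c ℕ.+ suc y) (ℕP.m<m+n c (s≤s z≤n)))) ⟩
  F c + 0ℚ                                               ≡⟨ ℚP.+-identityʳ (F c) ⟩
  F c                                                    ≡⟨ #completionsWith-open p k n c s ⟩
  #completions p k n (suc c) (bump s c)                  ∎
  where
  open ≡-Reasoning
  k = c ℕ.+ suc d
  F = #completionsWith p k n c s

#completions-suc : ∀ p n c d s → #completions p (c ℕ.+ d) (suc n) c s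
                   ≡ sumBelow c (λ x → #completions p (c ℕ.+ d) n c (bump s x)) + #opening p n c d s
#completions-suc p n c d s = begin
  #completions p k (suc n) c s                                            ≡⟨ countℚ-words-suc _ n k ⟩
  sumBelow k F                                                            ≡⟨ Σ-split c d F ⟩
  sumBelow c F + sumBelow d (λ y → F (c ℕ.+ y))                           ≡⟨ cong₂ _+_ (Σ-cong c (#completionsWith-< p k n c s))
                                                                                        (#completionsWith-≥ p n c d s) ⟩
  sumBelow c (λ x → #completions p k n c (bump s x)) + #opening p n c d s ∎
  where
  open ≡-Reasoning
  k = c ℕ.+ d
  F = #completionsWith p k n c s

-- blockEGF p is the exponential generating function of a single nonempty block with
-- admissible size, and completionEGF p s that of the ways to finish a block which
-- already has s elements.
blockEGF : (ℕ → Bool) → FPS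
blockEGF p zero    = 0ℚ
blockEGF p (suc r) = if p (suc r) then invFact (suc r) else 0ℚ

completionEGF : (ℕ → Bool) → ℕ → FPS
completionEGF p s r = if p (s ℕ.+ r) then invFact r else 0ℚ

completionsEGF : (ℕ → Bool) → ℕ → (ℕ → ℕ) → FPS
completionsEGF p zero    s = oneS
completionsEGF p (suc c) s = completionsEGF p c s *S completionEGF p (s c)

completionGF : (ℕ → Bool) → (c d : ℕ) → (ℕ → ℕ) → FPS
completionGF p c d s = scaleS (invFact d) (completionsEGF p c s *S powS (blockEGF p) d)

ΣS : ℕ → (ℕ → FPS) → FPS
ΣS c F n = sumBelow c (λ x → F x n)

ΣS-*S : ∀ c F G → ΣS c F *S G ≈ ΣS c (λ x → F x *S G)
ΣS-*S zero    F G = *S-zeroˡ G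
ΣS-*S (suc c) F G = ≈-trans (*S-distribʳ (ΣS c F) (F c) G) (+S-cong (ΣS-*S c F G) ≈-refl)

∂-completionEGF : ∀ p s → ∂ (completionEGF p s) ≈ completionEGF p (suc s)
∂-completionEGF p s n rewrite ℕP.+-suc s n with p (suc (s ℕ.+ n))
... | true  = trans (ℚP.*-comm (fromℕ (suc n)) (invFact (suc n))) (invFact-suc*suc n)
... | false = ℚP.*-zeroʳ (fromℕ (suc n))

∂-blockEGF : ∀ p → ∂ (blockEGF p) ≈ completionEGF p 1
∂-blockEGF p n with p (suc n)
... | true  = trans (ℚP.*-comm (fromℕ (suc n)) (invFact (suc n))) (invFact-suc*suc n)
... | false = ℚP.*-zeroʳ (fromℕ (suc n))

completionsEGF-cong : ∀ p c {s s′} → (∀ j → j < c → s j ≡ s′ j) → completionsEGF p c s ≈ completionsEGF p c s′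
completionsEGF-cong p zero    h = ≈-refl
completionsEGF-cong p (suc c) {s} {s′} h =
  *S-cong (completionsEGF-cong p c (λ j j<c → h j (ℕP.m<n⇒m<1+n j<c)))
          (λ n → cong (λ z → completionEGF p z n) (h c ℕP.≤-refl))

completionsEGF-bump-≥ : ∀ p c s {x} → c ≤ x → completionsEGF p c (bump s x) ≈ completionsEGF p c s
completionsEGF-bump-≥ p c s c≤x =
  completionsEGF-cong p c (λ j j<c → bump-other s (λ e → ℕP.<-irrefl (sym e) (ℕP.<-≤-trans j<c c≤x)))

completionsEGF-0 : ∀ p c s → completionsEGF p c s 0 ≡ 𝟙 (blocksOK p c s [])
completionsEGF-0 p zero    s = refl
completionsEGF-0 p (suc c) s = trans (*S-0 (completionsEGF p c s) (completionEGF p (s c)))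
  (trans (cong (_* completionEGF p (s c) 0) (completionsEGF-0 p c s)) (𝟙*𝟙 (blocksOK p c s []) (p (s c ℕ.+ 0))))

∂-completionsEGF : ∀ p c s → ∂ (completionsEGF p c s) ≈ ΣS c (λ x → completionsEGF p c (bump s x))
∂-completionsEGF p zero    s = ∂-oneS
∂-completionsEGF p (suc c) s n = begin
  ∂ (P *S E) n
    ≡⟨ ∂-*S P E n ⟩
  (∂ P *S E) n + (P *S ∂ E) n
    ≡⟨ cong₂ _+_ (trans (*S-congˡ E (∂-completionsEGF p c s) n) (ΣS-*S c _ E n))
                 (*S-cong (≈-sym (completionsEGF-bump-≥ p c s ℕP.≤-refl))
                          (≈-trans (∂-completionEGF p (s c)) (λ r → cong (λ z → completionEGF p z r) (sym (bump-same s c)))) n) ⟩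
  sumBelow c (λ x → (completionsEGF p c (bump s x) *S E) n) + (completionsEGF p c (bump s c) *S completionEGF p (bump s c c)) n
    ≡⟨ cong (_+ (completionsEGF p c (bump s c) *S completionEGF p (bump s c c)) n)
         (Σ-cong c (λ x x<c → *S-congʳ (completionsEGF p c (bump s x))
           (λ r → cong (λ z → completionEGF p z r) (sym (bump-other s (λ e → ℕP.<-irrefl e x<c)))) n)) ⟩
  ΣS (suc c) (λ x → completionsEGF p (suc c) (bump s x)) n
    ∎
  where
  open ≡-Reasoning
  P = completionsEGF p c s
  E = completionEGF p (s c)

∂-completionGF : ∀ p c d s → ∂ (completionGF p c d s)
                 ≈ ΣS c (λ x → completionGF p c d (bump s x)) +S scaleS (invFact d) (completionsEGF p c s *S ∂ (powS (blockEGF p) d))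
∂-completionGF p c d s n = begin
  ∂ (scaleS f (P *S T)) n                     ≡⟨ ∂-scaleS f (P *S T) n ⟩
  f * ∂ (P *S T) n                            ≡⟨ cong (f *_) (∂-*S P T n) ⟩
  f * ((∂ P *S T) n + (P *S ∂ T) n)           ≡⟨ cong (λ z → f * (z + (P *S ∂ T) n))
                                                   (trans (*S-congˡ T (∂-completionsEGF p c s) n) (ΣS-*S c _ T n)) ⟩
  f * (sumBelow c Pₓ + (P *S ∂ T) n)          ≡⟨ ℚP.*-distribˡ-+ f _ _ ⟩
  f * sumBelow c Pₓ + f * (P *S ∂ T) n        ≡⟨ cong (_+ f * (P *S ∂ T) n) (Σ-*ˡ c f Pₓ) ⟩
  sumBelow c (λ x → f * Pₓ x) + f * (P *S ∂ T) n ∎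
  where
  open ≡-Reasoning
  f = invFact d
  P = completionsEGF p c s
  T = powS (blockEGF p) d
  Pₓ = λ x → (completionsEGF p c (bump s x) *S T) n

completionsEGF-open : ∀ p c d s → EmptyFrom c s →
  completionsEGF p c s *S (powS (blockEGF p) d *S ∂ (blockEGF p)) ≈ completionsEGF p (suc c) (bump s c) *S powS (blockEGF p) d
completionsEGF-open p c d s empty = begin
  P *S (powS T d *S ∂ T)                ≈⟨ *S-congʳ P (≈-trans (*S-congʳ (powS T d) (∂-blockEGF p)) (*S-comm (powS T d) (completionEGF p 1))) ⟩
  P *S (completionEGF p 1 *S powS T d)  ≈⟨ ≈-sym (*S-assoc P (completionEGF p 1) (powS T d)) ⟩
  (P *S completionEGF p 1) *S powS T d  ≈⟨ *S-congˡ (powS T d) (*S-cong (≈-sym (completionsEGF-bump-≥ p c s ℕP.≤-refl)) E₁≈) ⟩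
  completionsEGF p (suc c) (bump s c) *S powS T d ∎
  where
  open ≈-Reasoning
  P = completionsEGF p c s
  T = blockEGF p
  E₁≈ : completionEGF p 1 ≈ completionEGF p (bump s c c)
  E₁≈ r = cong (λ z → completionEGF p z r) (sym (trans (bump-same s c) (cong suc (empty c ℕP.≤-refl))))

completionGF-open : ∀ p c d s → EmptyFrom c s →
  scaleS (invFact (suc d)) (completionsEGF p c s *S ∂ (powS (blockEGF p) (suc d))) ≈ completionGF p (suc c) d (bump s c)
completionGF-open p c d s empty n = begin
  invFact (suc d) * (P *S ∂ (powS T (suc d))) n                  ≡⟨ cong (invFact (suc d) *_) (trans (*S-congʳ P (∂-powS T d) n)
                                                                       (*S-scaleʳ (fromℕ (suc d)) P (powS T d *S ∂ T) n)) ⟩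
  invFact (suc d) * (fromℕ (suc d) * (P *S (powS T d *S ∂ T)) n) ≡⟨ sym (ℚP.*-assoc (invFact (suc d)) (fromℕ (suc d)) _) ⟩
  (invFact (suc d) * fromℕ (suc d)) * (P *S (powS T d *S ∂ T)) n ≡⟨ cong₂ _*_ (invFact-suc*suc d) (completionsEGF-open p c d s empty n) ⟩
  invFact d * (completionsEGF p (suc c) (bump s c) *S powS T d) n ∎
  where
  open ≡-Reasoning
  P = completionsEGF p c s
  T = blockEGF p

#completions≡coeff : ∀ p n c d s → EmptyFrom c s →
                     #completions p (c ℕ.+ d) n c s ≡ fromℕ (n !) * completionGF p c d s n
#completions≡coeff p zero c zero s empty = begin
  #completions p (c ℕ.+ 0) 0 c s                            ≡⟨ cong (λ k → #completions p k 0 c s) (ℕP.+-identityʳ c) ⟩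
  countℚ (λ w → isRGS c w c ∧ blocksOK p c s w) ([] ∷ [])  ≡⟨ countℚ-[ [] ] (λ w → isRGS c w c ∧ blocksOK p c s w) ⟩
  𝟙 ((c ≡ᵇ c) ∧ blocksOK p c s [])                          ≡⟨ cong (λ b → 𝟙 (b ∧ blocksOK p c s [])) (≡ᵇ-refl c) ⟩
  𝟙 (blocksOK p c s [])                                     ≡⟨ sym (completionsEGF-0 p c s) ⟩
  P 0                                                       ≡⟨ solve 1 (λ x → x := con 1ℚ :* (con 1ℚ :* (x :* con 1ℚ))) refl (P 0) ⟩
  1ℚ * (1ℚ * (P 0 * 1ℚ))                                    ≡⟨ cong (λ z → 1ℚ * (1ℚ * z)) (sym (*S-0 P oneS)) ⟩
  1ℚ * (1ℚ * (P *S oneS) 0)                                 ∎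
  where
  open ≡-Reasoning
  P = completionsEGF p c s
#completions≡coeff p zero c (suc d) s empty = begin
  countℚ f ([] ∷ [])                            ≡⟨ countℚ-[ [] ] f ⟩
  𝟙 ((c ≡ᵇ c ℕ.+ suc d) ∧ blocksOK p k s [])    ≡⟨ cong (λ b → 𝟙 (b ∧ blocksOK p k s [])) (≢⇒≡ᵇ-false (ℕP.<⇒≢ (ℕP.m<m+n c (s≤s z≤n)))) ⟩
  0ℚ                                            ≡⟨ sym (trans (cong (λ z → 1ℚ * (invFact (suc d) * z)) P*T0≡0)
                                                     (trans (cong (1ℚ *_) (ℚP.*-zeroʳ (invFact (suc d)))) (ℚP.*-zeroʳ 1ℚ))) ⟩
  1ℚ * (invFact (suc d) * (P *S T) 0)           ∎
  where
  open ≡-Reasoning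
  k = c ℕ.+ suc d
  f = λ w → isRGS c w k ∧ blocksOK p k s w
  P = completionsEGF p c s
  T = powS (blockEGF p) (suc d)
  P*T0≡0 : (P *S T) 0 ≡ 0ℚ
  P*T0≡0 = trans (*S-0 P T) (trans (cong (P 0 *_) (powS-vanishesBelow (blockEGF p) refl (suc d) 0 (s≤s z≤n)))
                                  (ℚP.*-zeroʳ (P 0)))
#completions≡coeff p (suc n) c d s empty = begin
  #completions p (c ℕ.+ d) (suc n) c s
    ≡⟨ #completions-suc p n c d s ⟩
  sumBelow c (λ x → #completions p (c ℕ.+ d) n c (bump s x)) + #opening p n c d s
    ≡⟨ cong₂ _+_ (Σ-cong c (λ x x<c → #completions≡coeff p n c d (bump s x) (EmptyFrom-bump-< x<c empty)))
                 (#opening≡coeff d) ⟩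
  sumBelow c (λ x → a * completionGF p c d (bump s x) n) + a * opened d n
    ≡⟨ cong (_+ a * opened d n) (sym (Σ-*ˡ c a (λ x → completionGF p c d (bump s x) n))) ⟩
  a * ΣS c (λ x → completionGF p c d (bump s x)) n + a * opened d n
    ≡⟨ sym (ℚP.*-distribˡ-+ a _ (opened d n)) ⟩
  a * (ΣS c (λ x → completionGF p c d (bump s x)) n + opened d n)
    ≡⟨ cong (a *_) (sym (∂-completionGF p c d s n)) ⟩
  a * ∂ (completionGF p c d s) n
    ≡⟨ fromℕ-!*∂ (completionGF p c d s) n ⟩
  fromℕ (suc n !) * completionGF p c d s (suc n)
    ∎
  where
  open ≡-Reasoning
  a = fromℕ (n !)
  opened : ℕ → FPS
  opened d′ = scaleS (invFact d′) (completionsEGF p c s *S ∂ (powS (blockEGF p) d′))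
  #opening≡coeff : ∀ d′ → #opening p n c d′ s ≡ a * opened d′ n
  #opening≡coeff zero = sym (trans (cong (λ z → a * (invFact 0 * z))
                                       (trans (*S-congʳ (completionsEGF p c s) ∂-oneS n) (*S-zeroʳ (completionsEGF p c s) n)))
                                 (trans (cong (a *_) (ℚP.*-zeroʳ (invFact 0))) (ℚP.*-zeroʳ a)))
  #opening≡coeff (suc d′) = begin
    #completions p (c ℕ.+ suc d′) n (suc c) (bump s c)  ≡⟨ cong (λ k → #completions p k n (suc c) (bump s c)) (ℕP.+-suc c d′) ⟩
    #completions p (suc c ℕ.+ d′) n (suc c) (bump s c)  ≡⟨ #completions≡coeff p n (suc c) d′ (bump s c) (EmptyFrom-bump-open empty) ⟩
    a * completionGF p (suc c) d′ (bump s c) n          ≡⟨ cong (a *_) (sym (completionGF-open p c d′ s empty n)) ⟩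
    a * opened (suc d′) n                               ∎

powS-blockEGF-coeff : ∀ p n k → powS (blockEGF p) k n ≡ (fromℕ (k !) * fromℕ (stirlingWith p n k)) * invFact n
powS-blockEGF-coeff p n k = sym (begin
  (fromℕ (k !) * fromℕ (stirlingWith p n k)) * invFact n        ≡⟨ cong (λ z → (fromℕ (k !) * z) * invFact n) stirling≡ ⟩
  (fromℕ (k !) * (fromℕ (n !) * (invFact k * t))) * invFact n   ≡⟨ solve 5 (λ K N fk t fn → (K :* (N :* (fk :* t))) :* fn := (fn :* N) :* ((fk :* K) :* t))
                                                                     refl (fromℕ (k !)) (fromℕ (n !)) (invFact k) t (invFact n) ⟩
  (invFact n * fromℕ (n !)) * ((invFact k * fromℕ (k !)) * t)   ≡⟨ cong₂ (λ x y → x * (y * t)) (invFact*!≡1 n) (invFact*!≡1 k) ⟩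
  1ℚ * (1ℚ * t)                                                 ≡⟨ trans (ℚP.*-identityˡ _) (ℚP.*-identityˡ t) ⟩
  t                                                             ∎)
  where
  open ≡-Reasoning
  t = powS (blockEGF p) k n
  stirling≡ : fromℕ (stirlingWith p n k) ≡ fromℕ (n !) * (invFact k * t)
  stirling≡ = trans (cong fromℕ (countIf-cong (words n k) (λ w → cong (isRGS 0 w k ∧_) (sym (blocksOK-empty p k w)))))
    (trans (#completions≡coeff p n 0 k (λ _ → 0) (λ _ _ → refl))
           (cong (λ z → fromℕ (n !) * (invFact k * z)) (*S-identityˡ (powS (blockEGF p) k) n)))

atNeg : FPS → FPS
atNeg A n = sign n * A n

atNeg-*S : ∀ A B → atNeg A *S atNeg B ≈ atNeg (A *S B)
atNeg-*S A B n = trans (Σ-cong (suc n) term) (sym (Σ-*ˡ (suc n) (sign n) _))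
  where
  term : ∀ i → i < suc n → (sign i * A i) * (sign (n ∸ i) * B (n ∸ i)) ≡ sign n * (A i * B (n ∸ i))
  term i (s≤s i≤n) = trans (solve 4 (λ a b x y → (a :* x) :* (b :* y) := (a :* b) :* (x :* y)) refl (sign i) (sign (n ∸ i)) (A i) (B (n ∸ i)))
    (cong (_* (A i * B (n ∸ i))) (trans (sym (sign-+ i (n ∸ i))) (cong sign (ℕP.m+[n∸m]≡n i≤n))))

atNeg-oneS : atNeg oneS ≈ oneS
atNeg-oneS zero    = refl
atNeg-oneS (suc n) = ℚP.*-zeroʳ (sign (suc n))

atNeg-powS : ∀ A k → powS (atNeg A) k ≈ atNeg (powS A k)
atNeg-powS A zero    = ≈-sym atNeg-oneS
atNeg-powS A (suc k) = ≈-trans (*S-congʳ (atNeg A) (atNeg-powS A k)) (atNeg-*S A (powS A k))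

liS-coeff : ∀ p μ u → u ≈ negS (atNeg (blockEGF p)) → ∀ n →
            liS μ u n ≡ polyBernoulliWith (stirlingWith p) μ n * invFact n
liS-coeff p μ u u≈ n = sym (trans (Σ-*ʳ (suc n) (invFact n) _) (Σ-cong (suc n) term))
  where
  term : ∀ k → k < suc n →
    (sign (n ∸ k) * ((+ (k !) / (suc k ^ μ)) {{ℕP.m^n≢0 (suc k) μ}} * (+ stirlingWith p n k / 1))) * invFact n
      ≡ liCoeff μ k * powS u k n
  term k (s≤s k≤n) = begin
    (sign (n ∸ k) * ((+ (k !) / (suc k ^ μ)) {{ℕP.m^n≢0 (suc k) μ}} * fromℕ S)) * invFact n
      ≡⟨ cong₂ (λ x y → (x * (y * fromℕ S)) * invFact n) (sign-∸ n k k≤n) (/≡fromℕ*1/ (k !) (suc k ^ μ) {{ℕP.m^n≢0 (suc k) μ}}) ⟩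
    ((sign n * sign k) * ((fromℕ (k !) * liCoeff μ k) * fromℕ S)) * invFact n
      ≡⟨ solve 6 (λ sn sk K c s f → ((sn :* sk) :* ((K :* c) :* s)) :* f := c :* (sk :* (sn :* ((K :* s) :* f)))) refl
           (sign n) (sign k) (fromℕ (k !)) (liCoeff μ k) (fromℕ S) (invFact n) ⟩
    liCoeff μ k * (sign k * (sign n * ((fromℕ (k !) * fromℕ S) * invFact n)))
      ≡⟨ cong (λ z → liCoeff μ k * (sign k * (sign n * z))) (sym (powS-blockEGF-coeff p n k)) ⟩
    liCoeff μ k * (sign k * (sign n * powS (blockEGF p) k n))
      ≡⟨ cong (liCoeff μ k *_) (sym (trans (powS-cong k u≈ n)
           (trans (powS-negS (atNeg (blockEGF p)) k n) (cong (sign k *_) (atNeg-powS (blockEGF p) k n))))) ⟩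
    liCoeff μ k * powS u k n
      ∎
    where
    open ≡-Reasoning
    S = stirlingWith p n k

∂-expNeg : ∂ expNeg ≈ negS expNeg
∂-expNeg n = trans (solve 3 (λ i s f → i :* ((:- s) :* f) := :- (s :* (f :* i))) refl (fromℕ (suc n)) (sign n) (invFact (suc n)))
  (cong (λ z → - (sign n * z)) (invFact-suc*suc n))

∂-Etr : ∀ k → ∂ (Etr (suc k)) ≈ negS (Etr k)
∂-Etr k n with n ℕ.<ᵇ k
... | true  = ∂-expNeg n
... | false = ℚP.*-zeroʳ (fromℕ (suc n))

∂-1-Etr : ∀ m → ∂ (oneS -S Etr (suc m)) ≈ Etr m
∂-1-Etr m n = begin
  fromℕ (suc n) * (0ℚ + - Etr (suc m) (suc n))  ≡⟨ solve 2 (λ i e → i :* (con 0ℚ :+ :- e) := :- (i :* e)) refl (fromℕ (suc n)) (Etr (suc m) (suc n)) ⟩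
  - (fromℕ (suc n) * Etr (suc m) (suc n))      ≡⟨ cong -_ (∂-Etr m n) ⟩
  - - Etr m n                                   ≡⟨ solve 1 (λ e → :- (:- e) := e) refl (Etr m n) ⟩
  Etr m n                                       ∎
  where open ≡-Reasoning

∂-Etr-expNeg : ∀ k → ∂ (Etr (suc k) -S expNeg) ≈ expNeg -S Etr k
∂-Etr-expNeg k n = begin
  fromℕ (suc n) * (Etr (suc k) (suc n) + - expNeg (suc n))
    ≡⟨ solve 3 (λ i e x → i :* (e :+ :- x) := i :* e :+ :- (i :* x)) refl (fromℕ (suc n)) (Etr (suc k) (suc n)) (expNeg (suc n)) ⟩
  ∂ (Etr (suc k)) n + - ∂ expNeg n
    ≡⟨ cong₂ (λ a b → a + - b) (∂-Etr k n) (∂-expNeg n) ⟩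
  - Etr k n + - - expNeg n
    ≡⟨ solve 2 (λ e x → :- e :+ :- (:- x) := x :+ :- e) refl (Etr k n) (expNeg n) ⟩
  expNeg n + - Etr k n
    ∎
  where open ≡-Reasoning

1-Etr-vanishesBelow1 : ∀ m → VanishesBelow 1 (oneS -S Etr (suc m))
1-Etr-vanishesBelow1 m zero    _        = refl
1-Etr-vanishesBelow1 m (suc j) (s≤s ())

1-Etr-lead≢0 : ∀ m → (oneS -S Etr (suc (suc m))) 1 ≢ 0ℚ
1-Etr-lead≢0 m ()

1-Etr≈-atNeg-blockEGF : ∀ m → oneS -S Etr (suc m) ≈ negS (atNeg (blockEGF (λ s → s ≤ᵇ m)))
1-Etr≈-atNeg-blockEGF m zero    = refl
1-Etr≈-atNeg-blockEGF m (suc n) with n ℕ.<ᵇ m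
... | true  = ℚP.+-identityˡ _
... | false = solve 1 (λ s → con 0ℚ :+ :- (con 0ℚ) := :- (s :* con 0ℚ)) refl (sign (suc n))

Etr-expNeg-vanishesBelow : ∀ m → VanishesBelow m (Etr m -S expNeg)
Etr-expNeg-vanishesBelow m j j<m =
  trans (cong (_+ - expNeg j) (if-cong (≤⇒≤ᵇ-true j<m))) (ℚP.+-inverseʳ (expNeg j))

Etr-expNeg-lead≢0 : ∀ m → (Etr m -S expNeg) m ≢ 0ℚ
Etr-expNeg-lead≢0 m eq = sign*invFact≢0 m (begin
  expNeg m                     ≡⟨ solve 1 (λ x → x := :- (con 0ℚ :+ :- x)) refl (expNeg m) ⟩
  - (0ℚ + - expNeg m)          ≡⟨ cong (λ b → - ((if b then expNeg m else 0ℚ) + - expNeg m)) (sym (>⇒≤ᵇ-false (ℕP.≤-refl {suc m}))) ⟩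
  - (Etr m -S expNeg) m        ≡⟨ cong -_ eq ⟩
  0ℚ                           ∎)
  where open ≡-Reasoning

Etr-expNeg≈-atNeg-blockEGF : ∀ m → 1 ≤ m → Etr m -S expNeg ≈ negS (atNeg (blockEGF (m ≤ᵇ_)))
Etr-expNeg≈-atNeg-blockEGF m 1≤m zero = Etr-expNeg-vanishesBelow m 0 1≤m
Etr-expNeg≈-atNeg-blockEGF m 1≤m (suc n) with suc n ℕ.<? m
... | yes n+1<m = begin
  Etr m (suc n) + - expNeg (suc n)                        ≡⟨ Etr-expNeg-vanishesBelow m (suc n) n+1<m ⟩
  0ℚ                                                      ≡⟨ solve 1 (λ s → con 0ℚ := :- (s :* con 0ℚ)) refl (sign (suc n)) ⟩
  - (sign (suc n) * 0ℚ)                                   ≡⟨ cong (λ b → - (sign (suc n) * (if b then invFact (suc n) else 0ℚ)))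
                                                               (sym (>⇒≤ᵇ-false n+1<m)) ⟩
  - atNeg (blockEGF (m ≤ᵇ_)) (suc n)                      ∎
  where open ≡-Reasoning
... | no n+1≮m = begin
  Etr m (suc n) + - expNeg (suc n)                        ≡⟨ cong (λ b → (if b then expNeg (suc n) else 0ℚ) + - expNeg (suc n))
                                                               (>⇒≤ᵇ-false (s≤s (ℕP.≮⇒≥ n+1≮m))) ⟩
  0ℚ + - expNeg (suc n)                                   ≡⟨ ℚP.+-identityˡ _ ⟩
  - expNeg (suc n)                                        ≡⟨ cong (λ b → - (sign (suc n) * (if b then invFact (suc n) else 0ℚ)))
                                                               (sym (≤⇒≤ᵇ-true (ℕP.≮⇒≥ n+1≮m))) ⟩
  - atNeg (blockEGF (m ≤ᵇ_)) (suc n)                      ∎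
  where open ≡-Reasoning

restricted : ∀ μ m → 1 ≤ μ → 1 ≤ m → ∀ n →
             divS 1 (Fser m μ) (oneS -S Etr (suc m)) n ≡ BLe μ m n * invFact n
restricted μ (suc m) 1≤μ _ n = trans
  (IteratedIntegral.divS-H≈liS 1 u (Etr (suc m)) (Etr (suc (suc m))) (Fser (suc m))
     ℕP.≤-refl (1-Etr-vanishesBelow1 (suc m)) (1-Etr-lead≢0 m) (∂-1-Etr (suc m)) W-1≈-u (λ _ → refl) (λ _ _ → refl) μ 1≤μ n)
  (liS-coeff (λ s → s ≤ᵇ suc m) μ u (1-Etr≈-atNeg-blockEGF (suc m)) n)
  where
  u = oneS -S Etr (suc (suc m))
  W-1≈-u : Etr (suc (suc m)) -S oneS ≈ negS u
  W-1≈-u k = solve 2 (λ e o → e :+ :- o := :- (o :+ :- e)) refl (Etr (suc (suc m)) k) (oneS k)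

associated : ∀ μ m → 1 ≤ μ → 1 ≤ m → ∀ n →
             divS m (Gser m μ) (Etr m -S expNeg) n ≡ BGe μ m n * invFact n
associated μ (suc m) 1≤μ 1≤m n = trans
  (IteratedIntegral.divS-H≈liS (suc m) u (expNeg -S Etr m) W (Gser (suc m))
     1≤m (Etr-expNeg-vanishesBelow (suc m)) (Etr-expNeg-lead≢0 (suc m)) (∂-Etr-expNeg m) W-1≈-u
     (λ _ → refl) (λ _ _ → refl) μ 1≤μ n)
  (liS-coeff (suc m ≤ᵇ_) μ u (Etr-expNeg≈-atNeg-blockEGF (suc m) 1≤m) n)
  where
  u = Etr (suc m) -S expNeg
  W = (oneS +S expNeg) -S Etr (suc m)
  W-1≈-u : W -S oneS ≈ negS u
  W-1≈-u k = solve 3 (λ o x e → ((o :+ x) :+ :- e) :+ :- o := :- (e :+ :- x)) refl (oneS k) (expNeg k) (Etr (suc m) k)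

theorem2 : (μ m : ℕ) → 1 ≤ μ → 1 ≤ m →
    ((n : ℕ) → divS 1 (Fser m μ) (oneS -S Etr (suc m)) n ≡ BLe μ m n * invFact n)
    × ((n : ℕ) → divS m (Gser m μ) (Etr m -S expNeg) n ≡ BGe μ m n * invFact n)
theorem2 μ m 1≤μ 1≤m = restricted μ m 1≤μ 1≤m , associated μ m 1≤μ 1≤m
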